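{- Let $G$ be a binary quasigroup of order $n$ with operation $*$ on $\{1,\ldots,n\}$ and let $k\ge1$. For $m\ge1$ and $U\in\{1,\ldots,n\}^{kn}$, let $l_U(m)$ be the number of $kn\times m$ tables $T$ with columns $T_1,\ldots,T_m$ such that each column is an arrangement of the multiset $I_{\{n,k\}}$ and $(\cdots((T_1*T_2)*T_3)*\cdots)*T_m=U$ (componentwise), and put $x_U(m)=\left(\frac{(kn)!}{k!^n}\right)^{ -m}l_U(m)$ and $X(m)=(x_U(m))_{U}$. Let $B(G)=(b_{U,V})$ be the matrix indexed by $U,V\in\{1,\ldots,n\}^{kn}$ with $b_{U,V}=\frac{k!^n}{(kn)!}\cdot\#\{W: W\text{ an arrangement of }I_{\{n,k\}},\ V*W=U\}$, so that $X(m)=B(G)X(m-1)$ for $m\ge2$. Let $E=(1,\ldots,1)\in\{1,\ldots,n\}^{kn}$. Then: (1) $x_E(m)>0$ for every even $m$; if $x_E(m')>0$ for some odd $m'$, then $x_E(m)>0$ for all $m\ge m'$. (2) There exists a constant $c=c(G)>0$ such that $\lim_{m\to\infty}x_E(m)=c$, where the limit is taken over all $m$ for which $x_E(m)\neq0$.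
   Context: $I_{\{n,k\}}$ denotes the multiset over $\{1,\ldots,n\}$ in which each symbol appears exactly $k$ times; an arrangement of it is a $kn$-vector containing each symbol of $\{1,\ldots,n\}$ exactly $k$ times. For vectors $U,V$ of the same length, $U*V$ is the componentwise product $(u_i*v_i)_i$. A binary quasigroup of order $n$ is a binary operation $*$ on $\{1,\ldots,n\}$ such that for all $a,b$ each of $a*x=b$ and $x*a=b$ has a unique solution $x$. -}

module Defs where

open import Data.Nat as ℕ using (ℕ; zero; suc; _≟_)
open import Data.Nat.Properties using (_!≢0)
open import Data.Nat.Combinatorics using ()
open import Data.Nat.Base using (_!)
open import Data.Fin as Fin using (Fin)
import Data.Fin.Properties as FinP
open import Data.Vec as Vec using (Vec; []; _∷_; zipWith; count; toList; replicate)
open import Data.Vec.Properties using (≡-dec)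
open import Data.List as List using (List; [_]; concatMap; map; filter; length; foldl; allFin)
open import Data.Product using (Σ; _×_; _,_)
open import Data.Integer using (+_)
open import Data.Rational as ℚ using (ℚ; _/_; _*_; 1ℚ)
open import Relation.Binary.PropositionalEquality using (_≡_)
open import Relation.Nullary using (Dec)

-- Symbols {1,…,n} are represented by Fin n (symbol 1 = Fin.zero).

IsQuasigroup : {n : ℕ} → (Fin n → Fin n → Fin n) → Set
IsQuasigroup {n} op =
  ((a b : Fin n) → Σ (Fin n) (λ x → op a x ≡ b × ((y : Fin n) → op a y ≡ b → y ≡ x))) ×
  ((a b : Fin n) → Σ (Fin n) (λ x → op x a ≡ b × ((y : Fin n) → op y a ≡ b → y ≡ x)))

module _ {n : ℕ} where

  allVecs : (L : ℕ) → List (Vec (Fin n) L)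
  allVecs zero = [ [] ]
  allVecs (suc L) = concatMap (λ s → map (s ∷_) (allVecs L)) (allFin n)

  IsArrangement : (k : ℕ) → Vec (Fin n) (k ℕ.* n) → Set
  IsArrangement k U = (s : Fin n) → count (λ x → x FinP.≟ s) U ≡ k

  isArrangement? : (k : ℕ) → (U : Vec (Fin n) (k ℕ.* n)) → Dec (IsArrangement k U)
  isArrangement? k U = FinP.all? (λ s → count (λ x → x FinP.≟ s) U ≟ k)

  arrangements : (k : ℕ) → List (Vec (Fin n) (k ℕ.* n))
  arrangements k = filter (isArrangement? k) (allVecs (k ℕ.* n))

  tables : (k m : ℕ) → List (Vec (Vec (Fin n) (k ℕ.* n)) m)
  tables k zero = [ [] ]
  tables k (suc m) = concatMap (λ c → map (c ∷_) (tables k m)) (arrangements k)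

  tableProduct : (Fin n → Fin n → Fin n) → {L m : ℕ} → Vec (Vec (Fin n) L) (suc m) → Vec (Fin n) L
  tableProduct op (c ∷ cs) = foldl (zipWith op) c (toList cs)

  -- l_U(m) for m ≥ 1 (l_U(0) := 0 is a dummy value, never used for m = 0)
  l : (Fin n → Fin n → Fin n) → (k : ℕ) → Vec (Fin n) (k ℕ.* n) → ℕ → ℕ
  l op k U zero = 0
  l op k U (suc m) =
    length (filter (λ T → ≡-dec FinP._≟_ (tableProduct op T) U) (tables k (suc m)))

  ratio : (k : ℕ) → ℚ
  ratio k = _/_ (+ ((k !) ℕ.^ n)) ((k ℕ.* n) !) {{(k ℕ.* n) !≢0}}

  powℚ : ℚ → ℕ → ℚ
  powℚ q zero = 1ℚ
  powℚ q (suc m) = q * powℚ q m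

  x : (Fin n → Fin n → Fin n) → (k : ℕ) → Vec (Fin n) (k ℕ.* n) → ℕ → ℚ
  x op k U m = ((+ l op k U m) / 1) * powℚ (ratio k) m

E : {n : ℕ} → (k : ℕ) → 0 ℕ.< n → Vec (Fin n) (k ℕ.* n)
E {n} k 0<n = replicate (k ℕ.* n) (Fin.fromℕ< 0<n)

{-# OPTIONS --safe #-}

-- Read the columns of a table as the steps X ↦ X * c of a walk on {1,…,n}^{kn}, where c ranges over
-- the D = (kn)!/k!^n arrangements: then x_U(m) = l_U(m)/D^m, and l_U(m+1) counts the m-step walks
-- from an arrangement to U. In a quasigroup every arrangement is one step away from E in either
-- direction, which gives walks from E back to E of every even length, and a step X ↦ X * c is undone
-- by 2·n! − 1 further steps with the same c, since each column acts by permutations whose orders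
-- divide n!. The sets of states reachable at times of a fixed parity increase, hence stabilise; with
-- reversibility this yields one time r such that every state reachable at an admissible time has a
-- walk of length exactly r to E. This is a Doeblin minorisation: after r more steps the spread of the
-- numbers of walks from admissible states to E is multiplied by D^r − 1 while the normalisation grows
-- by D^r, so along the times where x_E is nonzero it is bounded below and Cauchy.
module Submission where

module FiniteSums where

  open import Data.Bool using (true; false; if_then_else_)
  open import Data.Empty using (⊥-elim)
  open import Data.Fin using (Fin; zero; suc)
  open import Data.List using (List; []; _∷_; _++_; map; concatMap; filter; length; allFin)
  open import Data.List.Properties using (map-tabulate)
  open import Data.List.Membership.Propositional using (_∈_)
  open import Data.List.Relation.Unary.Any using (here; there)
  open import Data.Nat using (ℕ; zero; suc; _+_; _*_; _≤_; _<_; z≤n; s≤s)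
  open import Data.Nat.Properties
  open import Data.Product using (Σ-syntax; _×_; _,_)
  open import Function using (_∘_; _⇔_; Equivalence)
  open import Algebra.Properties.CommutativeSemigroup +-commutativeSemigroup
    renaming (interchange to +-interchange)
    using ()
  open import Relation.Binary.PropositionalEquality
  open import Relation.Nullary using (Dec; yes; no; does; ¬_)
  open import Relation.Unary using (Pred; Decidable)

  𝟙 : ∀ {p} {P : Set p} → Dec P → ℕ
  𝟙 P? = if does P? then 1 else 0

  module _ {p} {P : Set p} where

    𝟙-yes : (P? : Dec P) → P → 𝟙 P? ≡ 1
    𝟙-yes (yes _) _  = refl
    𝟙-yes (no ¬p) p′ = ⊥-elim (¬p p′)

    𝟙-no : (P? : Dec P) → ¬ P → 𝟙 P? ≡ 0
    𝟙-no (yes p′) ¬p = ⊥-elim (¬p p′)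
    𝟙-no (no _)   _  = refl

    𝟙≤1 : (P? : Dec P) → 𝟙 P? ≤ 1
    𝟙≤1 (yes _) = s≤s z≤n
    𝟙≤1 (no _)  = z≤n

    𝟙-positive : (P? : Dec P) → 1 ≤ 𝟙 P? → P
    𝟙-positive (yes p′) _ = p′

    𝟙-cong : ∀ {q} {Q : Set q} (P? : Dec P) (Q? : Dec Q) → P ⇔ Q → 𝟙 P? ≡ 𝟙 Q?
    𝟙-cong (yes _)  (yes _)  _   = refl
    𝟙-cong (no _)   (no _)   _   = refl
    𝟙-cong (yes p′) (no ¬q)  P⇔Q = ⊥-elim (¬q (Equivalence.to P⇔Q p′))
    𝟙-cong (no ¬p)  (yes q)  P⇔Q = ⊥-elim (¬p (Equivalence.from P⇔Q q))

  *-monoʳ-≤-on-support : ∀ w {m n} → (1 ≤ w → m ≤ n) → w * m ≤ w * n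
  *-monoʳ-≤-on-support zero    m≤n = z≤n
  *-monoʳ-≤-on-support (suc w) m≤n = *-monoʳ-≤ (suc w) (m≤n (s≤s z≤n))

  module _ {a} {A : Set a} where

    ∑ : List A → (A → ℕ) → ℕ
    ∑ []       f = 0
    ∑ (x ∷ xs) f = f x + ∑ xs f

    infix 10 ∑
    syntax ∑ xs (λ x → e) = ∑[ x ∈ xs ] e

    ∑-++ : ∀ xs ys f → ∑ (xs ++ ys) f ≡ ∑ xs f + ∑ ys f
    ∑-++ []       ys f = refl
    ∑-++ (x ∷ xs) ys f = trans (cong (f x +_) (∑-++ xs ys f)) (sym (+-assoc (f x) _ _))

    ∑-cong : ∀ xs {f g : A → ℕ} → (∀ x → f x ≡ g x) → ∑ xs f ≡ ∑ xs g
    ∑-cong []       f≗g = refl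
    ∑-cong (x ∷ xs) f≗g = cong₂ _+_ (f≗g x) (∑-cong xs f≗g)

    ∑-mono-≤ : ∀ xs {f g : A → ℕ} → (∀ x → f x ≤ g x) → ∑ xs f ≤ ∑ xs g
    ∑-mono-≤ []       f≤g = z≤n
    ∑-mono-≤ (x ∷ xs) f≤g = +-mono-≤ (f≤g x) (∑-mono-≤ xs f≤g)

    ∑-mono-< : ∀ xs {f g : A → ℕ} {x} → (∀ y → f y ≤ g y) → x ∈ xs → f x < g x → ∑ xs f < ∑ xs g
    ∑-mono-< (y ∷ xs) f≤g (here refl) fx<gx = +-mono-<-≤ fx<gx (∑-mono-≤ xs f≤g)
    ∑-mono-< (y ∷ xs) f≤g (there x∈) fx<gx = +-mono-≤-< (f≤g y) (∑-mono-< xs f≤g x∈ fx<gx)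

    ∑-distrib-+ : ∀ xs (f g : A → ℕ) → ∑[ x ∈ xs ] (f x + g x) ≡ ∑ xs f + ∑ xs g
    ∑-distrib-+ []       f g = refl
    ∑-distrib-+ (x ∷ xs) f g =
      trans (cong (f x + g x +_) (∑-distrib-+ xs f g)) (+-interchange (f x) (g x) _ _)

    *-distribˡ-∑ : ∀ xs c (f : A → ℕ) → c * ∑ xs f ≡ ∑[ x ∈ xs ] (c * f x)
    *-distribˡ-∑ []       c f = *-zeroʳ c
    *-distribˡ-∑ (x ∷ xs) c f = trans (*-distribˡ-+ c (f x) _) (cong (c * f x +_) (*-distribˡ-∑ xs c f))

    *-distribʳ-∑ : ∀ xs c (f : A → ℕ) → ∑ xs f * c ≡ ∑[ x ∈ xs ] (f x * c)
    *-distribʳ-∑ xs c f =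
      trans (*-comm (∑ xs f) c) (trans (*-distribˡ-∑ xs c f) (∑-cong xs (λ x → *-comm c (f x))))

    ∑-const : ∀ xs c → ∑[ x ∈ xs ] c ≡ length xs * c
    ∑-const []       c = refl
    ∑-const (x ∷ xs) c = cong (c +_) (∑-const xs c)

    ∑-zero : ∀ xs → ∑[ x ∈ xs ] 0 ≡ 0
    ∑-zero xs = trans (∑-const xs 0) (*-zeroʳ (length xs))

    ∈⇒≤∑ : ∀ xs (f : A → ℕ) {x} → x ∈ xs → f x ≤ ∑ xs f
    ∈⇒≤∑ (y ∷ xs) f (here refl) = m≤m+n (f y) _
    ∈⇒≤∑ (y ∷ xs) f (there x∈)  = ≤-trans (∈⇒≤∑ xs f x∈) (m≤n+m _ (f y))

    ∑-positive : ∀ xs (f : A → ℕ) → 1 ≤ ∑ xs f → Σ[ x ∈ A ] x ∈ xs × 1 ≤ f x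
    ∑-positive (x ∷ xs) f 1≤∑ with f x ≟ 0
    ... | no fx≢0  = x , here refl , n≢0⇒n>0 fx≢0
    ... | yes fx≡0 with ∑-positive xs f (subst (λ v → 1 ≤ v + ∑ xs f) fx≡0 1≤∑)
    ...   | y , y∈ , 1≤fy = y , there y∈ , 1≤fy

    ∑-weighted-≥ : ∀ xs (w h : A → ℕ) {lo} → (∀ x → 1 ≤ w x → lo ≤ h x) →
                   ∑ xs w * lo ≤ ∑[ x ∈ xs ] (w x * h x)
    ∑-weighted-≥ xs w h {lo} lo≤h = begin
      ∑ xs w * lo             ≡⟨ *-distribʳ-∑ xs lo w ⟩
      ∑[ x ∈ xs ] (w x * lo)  ≤⟨ ∑-mono-≤ xs (λ x → *-monoʳ-≤-on-support (w x) (lo≤h x)) ⟩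
      ∑[ x ∈ xs ] (w x * h x) ∎
      where open ≤-Reasoning

    ∑-weighted-≤ : ∀ xs (w h : A → ℕ) {hi} → (∀ x → 1 ≤ w x → h x ≤ hi) →
                   ∑[ x ∈ xs ] (w x * h x) ≤ ∑ xs w * hi
    ∑-weighted-≤ xs w h {hi} h≤hi = begin
      ∑[ x ∈ xs ] (w x * h x) ≤⟨ ∑-mono-≤ xs (λ x → *-monoʳ-≤-on-support (w x) (h≤hi x)) ⟩
      ∑[ x ∈ xs ] (w x * hi)  ≡⟨ *-distribʳ-∑ xs hi w ⟨
      ∑ xs w * hi             ∎
      where open ≤-Reasoning

    length-filter≡∑𝟙 : ∀ {p} {P : Pred A p} (P? : Decidable P) xs → length (filter P? xs) ≡ ∑[ x ∈ xs ] 𝟙 (P? x)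
    length-filter≡∑𝟙 P? []       = refl
    length-filter≡∑𝟙 P? (x ∷ xs) with does (P? x)
    ... | false = length-filter≡∑𝟙 P? xs
    ... | true  = cong suc (length-filter≡∑𝟙 P? xs)

  module _ {a b} {A : Set a} {B : Set b} where

    ∑-map : ∀ (g : A → B) xs f → ∑ (map g xs) f ≡ ∑[ x ∈ xs ] f (g x)
    ∑-map g []       f = refl
    ∑-map g (x ∷ xs) f = cong (f (g x) +_) (∑-map g xs f)

    ∑-concatMap : ∀ (g : A → List B) xs f → ∑ (concatMap g xs) f ≡ ∑[ x ∈ xs ] ∑ (g x) f
    ∑-concatMap g []       f = refl
    ∑-concatMap g (x ∷ xs) f = trans (∑-++ (g x) (concatMap g xs) f) (cong (∑ (g x) f +_) (∑-concatMap g xs f))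

    ∑-comm : ∀ xs ys (f : A → B → ℕ) → ∑[ x ∈ xs ] ∑[ y ∈ ys ] f x y ≡ ∑[ y ∈ ys ] ∑[ x ∈ xs ] f x y
    ∑-comm []       ys f = sym (∑-zero ys)
    ∑-comm (x ∷ xs) ys f =
      trans (cong (∑ ys (f x) +_) (∑-comm xs ys f)) (sym (∑-distrib-+ ys (f x) (λ y → ∑[ x′ ∈ xs ] f x′ y)))

  ∑-allFin-suc : ∀ {n} (f : Fin (suc n) → ℕ) → ∑ (allFin (suc n)) f ≡ f zero + ∑ (allFin n) (f ∘ suc)
  ∑-allFin-suc {n} f =
    cong (f zero +_) (trans (cong (λ xs → ∑ xs f) (sym (map-tabulate (λ i → i) suc))) (∑-map suc (allFin n) f))

module Multinomial where

  open FiniteSums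
  open import Defs
  open import Data.Fin using (Fin; zero; suc)
  import Data.Fin.Properties as Fin
  open import Data.List using (List; []; _∷_; map; filter; length; allFin)
  open import Data.List.Properties using (length-tabulate)
  open import Data.List.Membership.Propositional.Properties using (∈-allFin)
  open import Data.Nat using (ℕ; zero; suc; _+_; _*_; _^_; _≤_; pred; _!; >-nonZero)
  open import Data.Nat.Properties
  open import Data.Vec as Vec using (Vec; []; _∷_; count)
  open import Data.Vec.Functional using (updateAt)
  open import Data.Vec.Functional.Properties using (updateAt-updates; updateAt-minimal)
  open import Function using (_∘_; _⇔_; mk⇔)
  open import Algebra.Properties.CommutativeSemigroup *-commutativeSemigroup
    using () renaming (x∙yz≈y∙xz to *-left-comm)
  open import Relation.Binary.PropositionalEquality
  open import Relation.Nullary using (Dec; yes; no; ¬_)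
  open import Data.Empty using (⊥-elim)

  module _ {m : ℕ} where

    size : (Fin m → ℕ) → ℕ
    size c = ∑[ s ∈ allFin m ] c s

    decrement : Fin m → (Fin m → ℕ) → Fin m → ℕ
    decrement s c = updateAt c s pred

  ∏! : ∀ {m} → (Fin m → ℕ) → ℕ
  ∏! {zero}  c = 1
  ∏! {suc m} c = c zero ! * ∏! (c ∘ suc)

  decrement-size : ∀ {m} (s : Fin m) (c : Fin m → ℕ) → 1 ≤ c s → suc (size (decrement s c)) ≡ size c
  decrement-size {suc m} zero c 1≤cs = begin
    suc (size (decrement zero c))        ≡⟨ cong suc (∑-allFin-suc (decrement zero c)) ⟩
    suc (pred (c zero) + size (c ∘ suc)) ≡⟨ cong (_+ size (c ∘ suc)) (suc-pred (c zero) {{>-nonZero 1≤cs}}) ⟩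
    c zero + size (c ∘ suc)              ≡⟨ ∑-allFin-suc c ⟨
    size c                               ∎
    where open ≡-Reasoning
  decrement-size {suc m} (suc s) c 1≤cs = begin
    suc (size (decrement (suc s) c))            ≡⟨ cong suc (∑-allFin-suc (decrement (suc s) c)) ⟩
    suc (c zero + size (decrement s (c ∘ suc))) ≡⟨ +-suc (c zero) _ ⟨
    c zero + suc (size (decrement s (c ∘ suc))) ≡⟨ cong (c zero +_) (decrement-size s (c ∘ suc) 1≤cs) ⟩
    c zero + size (c ∘ suc)                     ≡⟨ ∑-allFin-suc c ⟨
    size c                                      ∎
    where open ≡-Reasoning

  *-∏!-decrement : ∀ {m} (s : Fin m) (c : Fin m → ℕ) → 1 ≤ c s → c s * ∏! (decrement s c) ≡ ∏! c
  *-∏!-decrement {suc m} zero c 1≤cs with c zero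
  ... | suc x = sym (*-assoc (suc x) (x !) _)
  *-∏!-decrement {suc m} (suc s) c 1≤cs =
    trans (*-left-comm (c (suc s)) (c zero !) _) (cong (c zero ! *_) (*-∏!-decrement s (c ∘ suc) 1≤cs))

  ∏!≡1 : ∀ {m} (c : Fin m → ℕ) → (∀ s → c s ≡ 0) → ∏! c ≡ 1
  ∏!≡1 {zero}  c c≡0 = refl
  ∏!≡1 {suc m} c c≡0 = cong₂ _*_ (cong _! (c≡0 zero)) (∏!≡1 (c ∘ suc) (c≡0 ∘ suc))

  module _ {n : ℕ} where

    occurrences : ∀ {L} → Vec (Fin n) L → Fin n → ℕ
    occurrences V s = count (Fin._≟ s) V

    HasProfile : ∀ {L} → (Fin n → ℕ) → Vec (Fin n) L → Set
    HasProfile c V = ∀ s → occurrences V s ≡ c s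

    hasProfile? : ∀ {L} (c : Fin n → ℕ) (V : Vec (Fin n) L) → Dec (HasProfile c V)
    hasProfile? c V = Fin.all? (λ s → occurrences V s ≟ c s)

    words : ℕ → (Fin n → ℕ) → ℕ
    words L c = length (filter (hasProfile? c) (allVecs L))

    occurrences-∷-≡ : ∀ {L} s (V : Vec (Fin n) L) → occurrences (s ∷ V) s ≡ suc (occurrences V s)
    occurrences-∷-≡ s V with s Fin.≟ s
    ... | yes _   = refl
    ... | no s≢s = ⊥-elim (s≢s refl)

    occurrences-∷-≢ : ∀ {L} {s t} (V : Vec (Fin n) L) → s ≢ t → occurrences (s ∷ V) t ≡ occurrences V t
    occurrences-∷-≢ {s = s} {t} V s≢t with s Fin.≟ t
    ... | yes s≡t = ⊥-elim (s≢t s≡t)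
    ... | no _    = refl

    hasProfile-∷ : ∀ {L} {c s} (V : Vec (Fin n) L) → 1 ≤ c s → HasProfile c (s ∷ V) ⇔ HasProfile (decrement s c) V
    hasProfile-∷ {c = c} {s} V 1≤cs = mk⇔ (λ h t → to h t (s Fin.≟ t)) (λ h t → from h t (s Fin.≟ t))
      where
      to : HasProfile c (s ∷ V) → ∀ t → Dec (s ≡ t) → occurrences V t ≡ decrement s c t
      to h t (yes refl) = trans (cong pred (trans (sym (occurrences-∷-≡ s V)) (h s))) (sym (updateAt-updates s c))
      to h t (no s≢t)   = trans (sym (occurrences-∷-≢ V s≢t)) (trans (h t) (sym (updateAt-minimal t s c (s≢t ∘ sym))))
      from : HasProfile (decrement s c) V → ∀ t → Dec (s ≡ t) → occurrences (s ∷ V) t ≡ c t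
      from h t (yes refl) = begin
        occurrences (s ∷ V) s ≡⟨ occurrences-∷-≡ s V ⟩
        suc (occurrences V s) ≡⟨ cong suc (trans (h s) (updateAt-updates s c)) ⟩
        suc (pred (c s))      ≡⟨ suc-pred (c s) {{>-nonZero 1≤cs}} ⟩
        c s                   ∎
        where open ≡-Reasoning
      from h t (no s≢t)   = trans (occurrences-∷-≢ V s≢t) (trans (h t) (updateAt-minimal t s c (s≢t ∘ sym)))

    ¬hasProfile-∷ : ∀ {L} {c s} (V : Vec (Fin n) L) → c s ≡ 0 → ¬ HasProfile c (s ∷ V)
    ¬hasProfile-∷ {s = s} V cs≡0 h = 0≢1+n (trans (sym cs≡0) (trans (sym (h s)) (occurrences-∷-≡ s V)))

    words-starting-with : ℕ → (Fin n → ℕ) → Fin n → ℕ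
    words-starting-with L c s = ∑[ V ∈ allVecs L ] 𝟙 (hasProfile? c (s ∷ V))

    words-suc : ∀ L c → words (suc L) c ≡ ∑[ s ∈ allFin n ] words-starting-with L c s
    words-suc L c = begin
      words (suc L) c                                                       ≡⟨ length-filter≡∑𝟙 (hasProfile? c) (allVecs (suc L)) ⟩
      ∑[ W ∈ allVecs (suc L) ] 𝟙 (hasProfile? c W)                          ≡⟨ ∑-concatMap _ (allFin n) _ ⟩
      ∑[ s ∈ allFin n ] ∑[ W ∈ map (s ∷_) (allVecs L) ] 𝟙 (hasProfile? c W) ≡⟨ ∑-cong (allFin n) (λ s → ∑-map (s ∷_) (allVecs L) _) ⟩
      ∑[ s ∈ allFin n ] words-starting-with L c s                           ∎
      where open ≡-Reasoning

    words-starting-with-absent : ∀ L {c s} → c s ≡ 0 → words-starting-with L c s ≡ 0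
    words-starting-with-absent L {c} {s} cs≡0 =
      trans (∑-cong (allVecs L) (λ V → 𝟙-no (hasProfile? c (s ∷ V)) (¬hasProfile-∷ V cs≡0))) (∑-zero (allVecs L))

    words-starting-with-present : ∀ L {c s} → 1 ≤ c s → words-starting-with L c s ≡ words L (decrement s c)
    words-starting-with-present L {c} {s} 1≤cs =
      trans (∑-cong (allVecs L) (λ V → 𝟙-cong (hasProfile? c (s ∷ V)) (hasProfile? (decrement s c) V) (hasProfile-∷ V 1≤cs)))
            (sym (length-filter≡∑𝟙 (hasProfile? (decrement s c)) (allVecs L)))

    words-*-∏! : ∀ L c → size c ≡ L → words L c * ∏! c ≡ L !
    words-*-∏! zero c size≡0 = begin
      words 0 c * ∏! c               ≡⟨ cong₂ _*_ (length-filter≡∑𝟙 (hasProfile? c) (allVecs 0)) (∏!≡1 c c≡0) ⟩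
      (𝟙 (hasProfile? c []) + 0) * 1 ≡⟨ cong (λ v → (v + 0) * 1) (𝟙-yes (hasProfile? c []) (λ s → sym (c≡0 s))) ⟩
      1                              ∎
      where
      open ≡-Reasoning
      c≡0 : ∀ s → c s ≡ 0
      c≡0 s = n≤0⇒n≡0 (subst (c s ≤_) size≡0 (∈⇒≤∑ (allFin n) c (∈-allFin s)))
    words-*-∏! (suc L) c size≡1+L = begin
      words (suc L) c * ∏! c                               ≡⟨ cong (_* ∏! c) (words-suc L c) ⟩
      (∑[ s ∈ allFin n ] words-starting-with L c s) * ∏! c ≡⟨ *-distribʳ-∑ (allFin n) (∏! c) _ ⟩
      ∑[ s ∈ allFin n ] (words-starting-with L c s * ∏! c) ≡⟨ ∑-cong (allFin n) (λ s → first-letter s (c s ≟ 0)) ⟩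
      ∑[ s ∈ allFin n ] (c s * L !)                        ≡⟨ *-distribʳ-∑ (allFin n) (L !) c ⟨
      size c * L !                                         ≡⟨ cong (_* L !) size≡1+L ⟩
      suc L !                                              ∎
      where
      open ≡-Reasoning
      first-letter : ∀ s → Dec (c s ≡ 0) → words-starting-with L c s * ∏! c ≡ c s * L !
      first-letter s (yes cs≡0) = begin
        words-starting-with L c s * ∏! c ≡⟨ cong (_* ∏! c) (words-starting-with-absent L cs≡0) ⟩
        0                                ≡⟨ cong (_* L !) cs≡0 ⟨
        c s * L !                        ∎
      first-letter s (no cs≢0) = begin
        words-starting-with L c s * ∏! c ≡⟨ cong (_* ∏! c) (words-starting-with-present L 1≤cs) ⟩
        words L c′ * ∏! c                ≡⟨ cong (words L c′ *_) (*-∏!-decrement s c 1≤cs) ⟨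
        words L c′ * (c s * ∏! c′)       ≡⟨ *-left-comm (words L c′) (c s) (∏! c′) ⟩
        c s * (words L c′ * ∏! c′)       ≡⟨ cong (c s *_) (words-*-∏! L c′ size≡L) ⟩
        c s * L !                        ∎
        where
        1≤cs = n≢0⇒n>0 cs≢0
        c′ = decrement s c
        size≡L : size c′ ≡ L
        size≡L = suc-injective (trans (decrement-size s c 1≤cs) size≡1+L)

  arrangements-count : ∀ {n} k → length (arrangements {n} k) * (k !) ^ n ≡ (k * n) !
  arrangements-count {n} k = trans (cong (length (arrangements {n} k) *_) (sym (∏!-const n k)))
    (words-*-∏! (k * n) (λ _ → k) (trans (∑-const (allFin n) k) (trans (cong (_* k) (length-tabulate {n = n} (λ i → i))) (*-comm n k))))
    where
    ∏!-const : ∀ m x → ∏! {m} (λ _ → x) ≡ (x !) ^ m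
    ∏!-const zero    x = refl
    ∏!-const (suc m) x = cong (x ! *_) (∏!-const m x)

module VectorEnumeration where

  open FiniteSums
  open import Defs using (allVecs)
  open import Data.Fin using (Fin; zero; suc)
  import Data.Fin.Properties as Fin
  open import Data.List using (List; []; _∷_; map; allFin)
  open import Data.List.Membership.Propositional using (_∈_)
  open import Data.Nat using (ℕ; zero; suc; _*_)
  open import Data.Nat.Properties
  open import Data.Product using (_,_)
  open import Data.Vec using (Vec; []; _∷_)
  open import Data.Vec.Properties using (≡-dec)
  open import Relation.Binary.PropositionalEquality
  open import Relation.Nullary using (Dec; yes; no; does)
  open import Relation.Binary.Definitions using (DecidableEquality)
  open import Data.Bool using (true; false)

  ∑-allFin-𝟙 : ∀ {n} (v : Fin n) → ∑[ s ∈ allFin n ] 𝟙 (v Fin.≟ s) ≡ 1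
  ∑-allFin-𝟙 {suc m} zero    = trans (∑-allFin-suc {m} (λ s → 𝟙 (zero Fin.≟ s))) (cong suc (∑-zero (allFin m)))
  ∑-allFin-𝟙 {suc m} (suc v) = trans (∑-allFin-suc {m} (λ s → 𝟙 (suc v Fin.≟ s))) (∑-allFin-𝟙 v)

  module _ {n : ℕ} where

    infix 4 _≟ᵥ_
    _≟ᵥ_ : ∀ {L} → DecidableEquality (Vec (Fin n) L)
    _≟ᵥ_ = ≡-dec Fin._≟_

    𝟙-≟ᵥ-∷ : ∀ {L} v s (V Z : Vec (Fin n) L) → 𝟙 (v ∷ V ≟ᵥ s ∷ Z) ≡ 𝟙 (v Fin.≟ s) * 𝟙 (V ≟ᵥ Z)
    𝟙-≟ᵥ-∷ v s V Z with does (v Fin.≟ s)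
    ... | true  = sym (+-identityʳ _)
    ... | false = refl

    ∑-allVecs-𝟙 : ∀ {L} (V : Vec (Fin n) L) → ∑[ Z ∈ allVecs L ] 𝟙 (V ≟ᵥ Z) ≡ 1
    ∑-allVecs-𝟙 []            = refl
    ∑-allVecs-𝟙 {suc L} (v ∷ V) = begin
      ∑[ Z ∈ allVecs (suc L) ] 𝟙 (v ∷ V ≟ᵥ Z)                          ≡⟨ ∑-concatMap _ (allFin n) _ ⟩
      ∑[ s ∈ allFin n ] ∑[ Z ∈ map (s ∷_) (allVecs L) ] 𝟙 (v ∷ V ≟ᵥ Z) ≡⟨ ∑-cong (allFin n) column ⟩
      ∑[ s ∈ allFin n ] 𝟙 (v Fin.≟ s)                                  ≡⟨ ∑-allFin-𝟙 v ⟩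
      1                                                                ∎
      where
      open ≡-Reasoning
      column : ∀ s → ∑[ Z ∈ map (s ∷_) (allVecs L) ] 𝟙 (v ∷ V ≟ᵥ Z) ≡ 𝟙 (v Fin.≟ s)
      column s = begin
        ∑[ Z ∈ map (s ∷_) (allVecs L) ] 𝟙 (v ∷ V ≟ᵥ Z)  ≡⟨ ∑-map (s ∷_) (allVecs L) _ ⟩
        ∑[ Z ∈ allVecs L ] 𝟙 (v ∷ V ≟ᵥ s ∷ Z)           ≡⟨ ∑-cong (allVecs L) (𝟙-≟ᵥ-∷ v s V) ⟩
        ∑[ Z ∈ allVecs L ] (𝟙 (v Fin.≟ s) * 𝟙 (V ≟ᵥ Z)) ≡⟨ *-distribˡ-∑ (allVecs L) (𝟙 (v Fin.≟ s)) (λ Z → 𝟙 (V ≟ᵥ Z)) ⟨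
        𝟙 (v Fin.≟ s) * (∑[ Z ∈ allVecs L ] 𝟙 (V ≟ᵥ Z)) ≡⟨ cong (𝟙 (v Fin.≟ s) *_) (∑-allVecs-𝟙 V) ⟩
        𝟙 (v Fin.≟ s) * 1                               ≡⟨ *-identityʳ _ ⟩
        𝟙 (v Fin.≟ s)                                   ∎

    ∑-allVecs-sift : ∀ {L} (V : Vec (Fin n) L) (f : Vec (Fin n) L → ℕ) → ∑[ Z ∈ allVecs L ] (𝟙 (V ≟ᵥ Z) * f Z) ≡ f V
    ∑-allVecs-sift {L} V f = begin
      ∑[ Z ∈ allVecs L ] (𝟙 (V ≟ᵥ Z) * f Z) ≡⟨ ∑-cong (allVecs L) (λ Z → at-V Z (V ≟ᵥ Z)) ⟩
      ∑[ Z ∈ allVecs L ] (𝟙 (V ≟ᵥ Z) * f V) ≡⟨ *-distribʳ-∑ (allVecs L) (f V) (λ Z → 𝟙 (V ≟ᵥ Z)) ⟨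
      (∑[ Z ∈ allVecs L ] 𝟙 (V ≟ᵥ Z)) * f V ≡⟨ cong (_* f V) (∑-allVecs-𝟙 V) ⟩
      1 * f V                               ≡⟨ *-identityˡ (f V) ⟩
      f V                                   ∎
      where
      open ≡-Reasoning
      at-V : ∀ Z (V≟Z : Dec (V ≡ Z)) → 𝟙 V≟Z * f Z ≡ 𝟙 V≟Z * f V
      at-V Z (yes refl) = refl
      at-V Z (no _)     = refl

    ∈-allVecs : ∀ {L} (V : Vec (Fin n) L) → V ∈ allVecs L
    ∈-allVecs {L} V with ∑-positive (allVecs L) (λ Z → 𝟙 (V ≟ᵥ Z)) (≤-reflexive (sym (∑-allVecs-𝟙 V)))
    ... | Z , Z∈ , 1≤𝟙 = subst (_∈ allVecs L) (sym (𝟙-positive (V ≟ᵥ Z) 1≤𝟙)) Z∈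

module WalkCounting where

  open FiniteSums
  open VectorEnumeration
  open import Defs
  open import Data.Fin using (Fin)
  open import Data.List using (List; []; _∷_; map; filter; length)
  open import Data.List.Membership.Propositional using (_∈_)
  open import Data.List.Membership.Propositional.Properties using (∈-filter⁺; ∈-filter⁻)
  open import Data.Nat using (ℕ; zero; suc; _+_; _*_; _^_; _≤_; _≤?_)
  open import Data.Nat.Properties
  open import Data.Product using (Σ-syntax; _×_; _,_; proj₂)
  open import Data.Vec using (Vec; []; _∷_; zipWith)
  open import Function using (_∘_)
  open import Relation.Binary.PropositionalEquality
  open import Relation.Nullary using (Dec)
  open import Relation.Nullary.Decidable using (map′)
  open import Relation.Unary using (Pred; Decidable)

  module Walks {n : ℕ} (_⋆_ : Fin n → Fin n → Fin n) (k : ℕ) where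

    State : Set
    State = Vec (Fin n) (k * n)

    states : List State
    states = allVecs (k * n)

    D : ℕ
    D = length (arrangements {n} k)

    infixl 7 _·_
    _·_ : State → State → State
    X · c = zipWith _⋆_ X c

    ∈-arrangements : ∀ c → IsArrangement k c → c ∈ arrangements k
    ∈-arrangements c = ∈-filter⁺ (isArrangement? k) {xs = states} (∈-allVecs c)

    ∈-arrangements⁻ : ∀ {c} → c ∈ arrangements k → IsArrangement k c
    ∈-arrangements⁻ c∈ = proj₂ (∈-filter⁻ (isArrangement? k) {xs = states} c∈)

    length-filter-tables : ∀ t {p} {P : Pred (Vec State (suc t)) p} (P? : Decidable P) →
      length (filter P? (tables k (suc t))) ≡ ∑[ c ∈ arrangements k ] length (filter (P? ∘ (c ∷_)) (tables k t))
    length-filter-tables t P? =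
      trans (length-filter≡∑𝟙 P? (tables k (suc t)))
      (trans (∑-concatMap (λ c → map (c ∷_) (tables k t)) (arrangements k) _)
      (∑-cong (arrangements k) (λ c → trans (∑-map (c ∷_) (tables k t) _) (sym (length-filter≡∑𝟙 (P? ∘ (c ∷_)) (tables k t))))))

    walks : ℕ → State → State → ℕ
    walks t X Y = length (filter (λ cs → tableProduct _⋆_ (X ∷ cs) ≟ᵥ Y) (tables k t))

    walks-zero : ∀ X Y → walks 0 X Y ≡ 𝟙 (X ≟ᵥ Y)
    walks-zero X Y = trans (length-filter≡∑𝟙 (λ cs → tableProduct _⋆_ (X ∷ cs) ≟ᵥ Y) (tables k 0)) (+-identityʳ (𝟙 (X ≟ᵥ Y)))

    walks-suc : ∀ t X Y → walks (suc t) X Y ≡ ∑[ c ∈ arrangements k ] walks t (X · c) Y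
    walks-suc t X Y = length-filter-tables t (λ cs → tableProduct _⋆_ (X ∷ cs) ≟ᵥ Y)

    l-suc : ∀ t U → l _⋆_ k U (suc t) ≡ ∑[ c ∈ arrangements k ] walks t c U
    l-suc t U = length-filter-tables t (λ T → tableProduct _⋆_ T ≟ᵥ U)

    ∑-walks : ∀ t X → ∑[ Y ∈ states ] walks t X Y ≡ D ^ t
    ∑-walks zero    X = trans (∑-cong states (walks-zero X)) (∑-allVecs-𝟙 X)
    ∑-walks (suc t) X = begin
      ∑[ Y ∈ states ] walks (suc t) X Y                         ≡⟨ ∑-cong states (walks-suc t X) ⟩
      ∑[ Y ∈ states ] ∑[ c ∈ arrangements k ] walks t (X · c) Y ≡⟨ ∑-comm states (arrangements k) _ ⟩
      ∑[ c ∈ arrangements k ] ∑[ Y ∈ states ] walks t (X · c) Y ≡⟨ ∑-cong (arrangements k) (λ c → ∑-walks t (X · c)) ⟩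
      ∑[ c ∈ arrangements k ] (D ^ t)                           ≡⟨ ∑-const (arrangements k) (D ^ t) ⟩
      D * D ^ t                                                 ∎
      where open ≡-Reasoning

    walks-+ : ∀ a b X Y → walks (a + b) X Y ≡ ∑[ Z ∈ states ] (walks a X Z * walks b Z Y)
    walks-+ zero    b X Y = begin
      walks b X Y                                 ≡⟨ ∑-allVecs-sift X (λ Z → walks b Z Y) ⟨
      ∑[ Z ∈ states ] (𝟙 (X ≟ᵥ Z) * walks b Z Y)  ≡⟨ ∑-cong states (λ Z → cong (_* walks b Z Y) (walks-zero X Z)) ⟨
      ∑[ Z ∈ states ] (walks 0 X Z * walks b Z Y) ∎
      where open ≡-Reasoning
    walks-+ (suc a) b X Y = begin
      walks (suc a + b) X Y                                                       ≡⟨ walks-suc (a + b) X Y ⟩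
      ∑[ c ∈ arrangements k ] walks (a + b) (X · c) Y                             ≡⟨ ∑-cong (arrangements k) (λ c → walks-+ a b (X · c) Y) ⟩
      ∑[ c ∈ arrangements k ] ∑[ Z ∈ states ] (walks a (X · c) Z * walks b Z Y)   ≡⟨ ∑-comm (arrangements k) states _ ⟩
      ∑[ Z ∈ states ] ∑[ c ∈ arrangements k ] (walks a (X · c) Z * walks b Z Y)   ≡⟨ ∑-cong states (λ Z → *-distribʳ-∑ (arrangements k) (walks b Z Y) _) ⟨
      ∑[ Z ∈ states ] ((∑[ c ∈ arrangements k ] walks a (X · c) Z) * walks b Z Y) ≡⟨ ∑-cong states (λ Z → cong (_* walks b Z Y) (walks-suc a X Z)) ⟨
      ∑[ Z ∈ states ] (walks (suc a) X Z * walks b Z Y)                           ∎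
      where open ≡-Reasoning

    l-+ : ∀ a b U → l _⋆_ k U (suc (a + b)) ≡ ∑[ Z ∈ states ] (l _⋆_ k Z (suc a) * walks b Z U)
    l-+ a b U = begin
      l _⋆_ k U (suc (a + b))                                               ≡⟨ l-suc (a + b) U ⟩
      ∑[ c ∈ arrangements k ] walks (a + b) c U                             ≡⟨ ∑-cong (arrangements k) (λ c → walks-+ a b c U) ⟩
      ∑[ c ∈ arrangements k ] ∑[ Z ∈ states ] (walks a c Z * walks b Z U)   ≡⟨ ∑-comm (arrangements k) states _ ⟩
      ∑[ Z ∈ states ] ∑[ c ∈ arrangements k ] (walks a c Z * walks b Z U)   ≡⟨ ∑-cong states (λ Z → *-distribʳ-∑ (arrangements k) (walks b Z U) _) ⟨
      ∑[ Z ∈ states ] ((∑[ c ∈ arrangements k ] walks a c Z) * walks b Z U) ≡⟨ ∑-cong states (λ Z → cong (_* walks b Z U) (l-suc a Z)) ⟨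
      ∑[ Z ∈ states ] (l _⋆_ k Z (suc a) * walks b Z U)                     ∎
      where open ≡-Reasoning

    ∑-l : ∀ a → ∑[ Z ∈ states ] l _⋆_ k Z (suc a) ≡ D ^ suc a
    ∑-l a = begin
      ∑[ Z ∈ states ] l _⋆_ k Z (suc a)                   ≡⟨ ∑-cong states (l-suc a) ⟩
      ∑[ Z ∈ states ] ∑[ c ∈ arrangements k ] walks a c Z ≡⟨ ∑-comm states (arrangements k) _ ⟩
      ∑[ c ∈ arrangements k ] ∑[ Z ∈ states ] walks a c Z ≡⟨ ∑-cong (arrangements k) (λ c → ∑-walks a c) ⟩
      ∑[ c ∈ arrangements k ] (D ^ a)                     ≡⟨ ∑-const (arrangements k) (D ^ a) ⟩
      D ^ suc a                                           ∎
      where open ≡-Reasoning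

    data Walk : State → State → ℕ → Set where
      done : ∀ {X} → Walk X X 0
      step : ∀ {X Y t} c → IsArrangement k c → Walk (X · c) Y t → Walk X Y (suc t)

    infixr 5 _++ʷ_
    _++ʷ_ : ∀ {X Y Z a b} → Walk X Y a → Walk Y Z b → Walk X Z (a + b)
    done            ++ʷ w′ = w′
    step c c-arr w ++ʷ w′ = step c c-arr (w ++ʷ w′)

    splitʷ : ∀ a {b X Z} → Walk X Z (a + b) → Σ[ Y ∈ State ] Walk X Y a × Walk Y Z b
    splitʷ zero    {X = X} w   = X , done , w
    splitʷ (suc a) (step c c-arr w) with splitʷ a w
    ... | Y , w₁ , w₂ = Y , step c c-arr w₁ , w₂

    walk⇒1≤walks : ∀ {X Y t} → Walk X Y t → 1 ≤ walks t X Y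
    walk⇒1≤walks {X} done = ≤-reflexive (sym (trans (walks-zero X X) (𝟙-yes (X ≟ᵥ X) refl)))
    walk⇒1≤walks {X} {Y} (step {t = t} c c-arr w) = begin
      1                                           ≤⟨ walk⇒1≤walks w ⟩
      walks t (X · c) Y                           ≤⟨ ∈⇒≤∑ (arrangements k) (λ c′ → walks t (X · c′) Y) (∈-arrangements c c-arr) ⟩
      ∑[ c′ ∈ arrangements k ] walks t (X · c′) Y ≡⟨ walks-suc t X Y ⟨
      walks (suc t) X Y                           ∎
      where open ≤-Reasoning

    1≤walks⇒walk : ∀ t X Y → 1 ≤ walks t X Y → Walk X Y t
    1≤walks⇒walk zero X Y 1≤w with 𝟙-positive (X ≟ᵥ Y) (subst (1 ≤_) (walks-zero X Y) 1≤w)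
    ... | refl = done
    1≤walks⇒walk (suc t) X Y 1≤w with ∑-positive (arrangements k) (λ c → walks t (X · c) Y) (subst (1 ≤_) (walks-suc t X Y) 1≤w)
    ... | c , c∈ , 1≤w′ = step c (∈-arrangements⁻ c∈) (1≤walks⇒walk t (X · c) Y 1≤w′)

    Reachable : ℕ → State → Set
    Reachable t Z = Σ[ c ∈ State ] IsArrangement k c × Walk c Z t

    reachable⇒1≤l : ∀ {t Z} → Reachable t Z → 1 ≤ l _⋆_ k Z (suc t)
    reachable⇒1≤l {t} {Z} (c , c-arr , w) = begin
      1                                     ≤⟨ walk⇒1≤walks w ⟩
      walks t c Z                           ≤⟨ ∈⇒≤∑ (arrangements k) (λ c′ → walks t c′ Z) (∈-arrangements c c-arr) ⟩
      ∑[ c′ ∈ arrangements k ] walks t c′ Z ≡⟨ l-suc t Z ⟨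
      l _⋆_ k Z (suc t)                     ∎
      where open ≤-Reasoning

    1≤l⇒reachable : ∀ t Z → 1 ≤ l _⋆_ k Z (suc t) → Reachable t Z
    1≤l⇒reachable t Z 1≤l with ∑-positive (arrangements k) (λ c → walks t c Z) (subst (1 ≤_) (l-suc t Z) 1≤l)
    ... | c , c∈ , 1≤w = c , ∈-arrangements⁻ c∈ , 1≤walks⇒walk t c Z 1≤w

    reachable? : ∀ t Z → Dec (Reachable t Z)
    reachable? t Z = map′ (1≤l⇒reachable t Z) reachable⇒1≤l (1 ≤? l _⋆_ k Z (suc t))

    reachable-++ : ∀ {a b Z U} → Reachable a Z → Walk Z U b → Reachable (a + b) U
    reachable-++ (c , c-arr , w) w′ = c , c-arr , w ++ʷ w′

module Iteration where

  open import Data.Fin using (Fin; toℕ)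
  import Data.Fin.Properties as Fin
  open import Data.Nat using (ℕ; zero; suc; _+_; _*_; _∸_; _≤_; _!)
  open import Data.Nat.Divisibility using (divides; ∣-trans; m∣m*n; m≤n⇒m!∣n!)
  open import Data.Nat.GeneralisedArithmetic using (iterate)
  open import Data.Nat.Properties
  open import Data.Product using (Σ-syntax; _×_; _,_)
  open import Function using (_∘_; Injective)
  open import Relation.Binary.PropositionalEquality

  module _ {a} {A : Set a} (f : A → A) where

    iterate-+ : ∀ x i j → iterate f x (i + j) ≡ iterate f (iterate f x i) j
    iterate-+ x zero    j = refl
    iterate-+ x (suc i) j = iterate-+ (f x) i j

    iterate-fixed : ∀ {x} → f x ≡ x → ∀ m → iterate f x m ≡ x
    iterate-fixed fx≡x zero    = refl
    iterate-fixed fx≡x (suc m) = trans (cong (λ y → iterate f y m) fx≡x) (iterate-fixed fx≡x m)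

    iterate-*-fixed : ∀ {x d} → iterate f x d ≡ x → ∀ q → iterate f x (q * d) ≡ x
    iterate-*-fixed         fx≡x zero    = refl
    iterate-*-fixed {x} {d} fx≡x (suc q) =
      trans (iterate-+ x d (q * d)) (trans (cong (λ y → iterate f y (q * d)) fx≡x) (iterate-*-fixed fx≡x q))

    iterate-injective : Injective _≡_ _≡_ f → ∀ i {x y} → iterate f x i ≡ iterate f y i → x ≡ y
    iterate-injective inj zero    eq = eq
    iterate-injective inj (suc i) eq = inj (iterate-injective inj i eq)

  iterate-period : ∀ {n} (f : Fin n → Fin n) → Injective _≡_ _≡_ f → ∀ x →
                   Σ[ d ∈ ℕ ] 1 ≤ d × d ≤ n × iterate f x d ≡ x
  iterate-period {n} f inj x with Fin.pigeonhole (n<1+n n) (iterate f x ∘ toℕ)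
  ... | i , j , i<j , fⁱx≡fʲx = toℕ j ∸ toℕ i , m<n⇒0<n∸m i<j , d≤n , fᵈx≡x
    where
    d≤n : toℕ j ∸ toℕ i ≤ n
    d≤n = ≤-trans (m∸n≤m (toℕ j) (toℕ i)) (Fin.toℕ≤pred[n] j)
    fᵈx≡x : iterate f x (toℕ j ∸ toℕ i) ≡ x
    fᵈx≡x = iterate-injective f inj (toℕ i) (begin
      iterate f (iterate f x (toℕ j ∸ toℕ i)) (toℕ i) ≡⟨ iterate-+ f x (toℕ j ∸ toℕ i) (toℕ i) ⟨
      iterate f x (toℕ j ∸ toℕ i + toℕ i)             ≡⟨ cong (iterate f x) (m∸n+n≡m (<⇒≤ i<j)) ⟩
      iterate f x (toℕ j)                             ≡⟨ fⁱx≡fʲx ⟨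
      iterate f x (toℕ i)                             ∎)
      where open ≡-Reasoning

  iterate-n! : ∀ {n} (f : Fin n → Fin n) → Injective _≡_ _≡_ f → ∀ x → iterate f x (n !) ≡ x
  iterate-n! f inj x with iterate-period f inj x
  ... | suc d , _ , d≤n , fᵈx≡x with ∣-trans (m∣m*n {suc d} (d !)) (m≤n⇒m!∣n! d≤n)
  ...   | divides q n!≡q*d = trans (cong (iterate f x) n!≡q*d) (iterate-*-fixed f fᵈx≡x q)

module Quasigroups where

  open FiniteSums
  open VectorEnumeration
  open Multinomial using (occurrences; arrangements-count)
  open WalkCounting
  open Iteration
  open import Defs
  open import Data.Fin using (Fin; fromℕ<)
  import Data.Fin.Properties as Fin
  open import Data.Nat using (ℕ; zero; suc; _+_; _*_; _^_; _<_; _!; pred)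
  open import Data.Nat.GeneralisedArithmetic using (iterate)
  open import Data.Nat.Properties
  open import Data.List using (List; []; _∷_; length)
  open import Data.List.Membership.Propositional using (_∈_)
  open import Data.List.Relation.Unary.Any using (here)
  open import Data.Product using (Σ-syntax; _,_; proj₁; proj₂)
  open import Data.Vec as Vec using (Vec; []; _∷_; zipWith; replicate)
  open import Function using (Injective)
  open import Relation.Binary.PropositionalEquality
  open import Relation.Nullary using (yes; no)
  open import Data.Empty using (⊥-elim)

  module Division {n} (_⋆_ : Fin n → Fin n → Fin n) (Qg : IsQuasigroup _⋆_) where

    infixl 7 _\\_ _//_

    _\\_ : Fin n → Fin n → Fin n
    a \\ b = proj₁ (proj₁ Qg a b)

    _//_ : Fin n → Fin n → Fin n
    b // a = proj₁ (proj₂ Qg a b)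

    ⋆-\\ : ∀ a b → a ⋆ (a \\ b) ≡ b
    ⋆-\\ a b = proj₁ (proj₂ (proj₁ Qg a b))

    \\-unique : ∀ {a b x} → a ⋆ x ≡ b → x ≡ a \\ b
    \\-unique {a} {b} {x} = proj₂ (proj₂ (proj₁ Qg a b)) x

    //-⋆ : ∀ a b → (b // a) ⋆ a ≡ b
    //-⋆ a b = proj₁ (proj₂ (proj₂ Qg a b))

    //-unique : ∀ {a b x} → x ⋆ a ≡ b → x ≡ b // a
    //-unique {a} {b} {x} = proj₂ (proj₂ (proj₂ Qg a b)) x

    ⋆-cancelʳ : ∀ a → Injective _≡_ _≡_ (_⋆ a)
    ⋆-cancelʳ a {x} {y} x⋆a≡y⋆a = trans (//-unique x⋆a≡y⋆a) (sym (//-unique refl))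

  module _ {n : ℕ} (f g : Fin n → Fin n) (g∘f≗id : ∀ x → g (f x) ≡ x) (f∘g≗id : ∀ y → f (g y) ≡ y) where

    occurrences-map : ∀ {L} (V : Vec (Fin n) L) s → occurrences (Vec.map f V) s ≡ occurrences V (g s)
    occurrences-map []      s = refl
    occurrences-map (x ∷ V) s with f x Fin.≟ s | x Fin.≟ g s
    ... | yes _    | yes _    = cong suc (occurrences-map V s)
    ... | no _     | no _     = occurrences-map V s
    ... | yes fx≡s | no x≢gs  = ⊥-elim (x≢gs (trans (sym (g∘f≗id x)) (cong g fx≡s)))
    ... | no fx≢s  | yes x≡gs = ⊥-elim (fx≢s (trans (cong f x≡gs) (f∘g≗id s)))

    isArrangement-map : ∀ {k} (V : Vec (Fin n) (k * n)) → IsArrangement k V → IsArrangement k (Vec.map f V)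
    isArrangement-map V V-arr s = trans (occurrences-map V s) (V-arr (g s))

  module QuasigroupWalks {n} (_⋆_ : Fin n → Fin n → Fin n) (Qg : IsQuasigroup _⋆_) (k : ℕ) (0<n : 0 < n) where

    open Walks _⋆_ k
    open Division _⋆_ Qg

    e : Fin n
    e = fromℕ< 0<n

    Eᵏ : State
    Eᵏ = E k 0<n

    ⋆-\\e : ∀ {L} (Z : Vec (Fin n) L) → zipWith _⋆_ Z (Vec.map (_\\ e) Z) ≡ replicate L e
    ⋆-\\e []      = refl
    ⋆-\\e (z ∷ Z) = cong₂ _∷_ (⋆-\\ z e) (⋆-\\e Z)

    e⋆-e\\ : ∀ {L} (Z : Vec (Fin n) L) → zipWith _⋆_ (replicate L e) (Vec.map (e \\_) Z) ≡ Z
    e⋆-e\\ []      = refl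
    e⋆-e\\ (z ∷ Z) = cong₂ _∷_ (⋆-\\ e z) (e⋆-e\\ Z)

    walk-to-E : ∀ Z → IsArrangement k Z → Walk Z Eᵏ 1
    walk-to-E Z Z-arr = subst (λ W → Walk Z W 1) (⋆-\\e Z) (step (Vec.map (_\\ e) Z) \\e-arr done)
      where
      \\e-arr : IsArrangement k (Vec.map (_\\ e) Z)
      \\e-arr = isArrangement-map (_\\ e) (e //_) (λ x → sym (//-unique (⋆-\\ x e))) (λ y → sym (\\-unique (//-⋆ y e))) Z Z-arr

    walk-from-E : ∀ Z → IsArrangement k Z → Walk Eᵏ Z 1
    walk-from-E Z Z-arr = subst (λ W → Walk Eᵏ W 1) (e⋆-e\\ Z) (step (Vec.map (e \\_) Z) e\\-arr done)
      where
      e\\-arr : IsArrangement k (Vec.map (e \\_) Z)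
      e\\-arr = isArrangement-map (e \\_) (e ⋆_) (⋆-\\ e) (λ x → sym (\\-unique refl)) Z Z-arr

    some-arrangement : Σ[ c ∈ State ] IsArrangement k c
    some-arrangement with arrangements {n} k in eq
    ... | c ∷ _ = c , ∈-arrangements⁻ (subst (c ∈_) (sym eq) (here refl))
    ... | []    = ⊥-elim (<⇒≢ (1≤n! (k * n)) (trans (cong (λ cs → length cs * (k !) ^ n) (sym eq)) (arrangements-count k)))

    c₀ : State
    c₀ = proj₁ some-arrangement

    c₀-arr : IsArrangement k c₀
    c₀-arr = proj₂ some-arrangement

    cycles : ∀ d → Walk Eᵏ Eᵏ (d * 2)
    cycles zero    = done
    cycles (suc d) = walk-from-E c₀ c₀-arr ++ʷ walk-to-E c₀ c₀-arr ++ʷ cycles d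

    E-reachable-odd : ∀ h → Reachable (suc (h * 2)) Eᵏ
    E-reachable-odd h = c₀ , c₀-arr , walk-to-E c₀ c₀-arr ++ʷ cycles h

    reachable-+2 : ∀ {t Z} → Reachable t Z → Reachable (2 + t) Z
    reachable-+2 (c , c-arr , w) = c , c-arr , walk-to-E c c-arr ++ʷ walk-from-E c c-arr ++ʷ w

    iterate-·-∷ : ∀ {L} m x w (X c : Vec (Fin n) L) →
      iterate (λ Y → zipWith _⋆_ Y (w ∷ c)) (x ∷ X) m ≡ iterate (_⋆ w) x m ∷ iterate (λ Y → zipWith _⋆_ Y c) X m
    iterate-·-∷ zero    x w X c = refl
    iterate-·-∷ (suc m) x w X c = iterate-·-∷ m (x ⋆ w) w (zipWith _⋆_ X c) c

    iterate-·-n! : ∀ {L} (X c : Vec (Fin n) L) → iterate (λ Y → zipWith _⋆_ Y c) X (n !) ≡ X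
    iterate-·-n! []      []      = iterate-fixed (λ Y → zipWith _⋆_ Y []) refl (n !)
    iterate-·-n! (x ∷ X) (w ∷ c) =
      trans (iterate-·-∷ (n !) x w X c) (cong₂ _∷_ (iterate-n! (_⋆ w) (⋆-cancelʳ w) x) (iterate-·-n! X c))

    -- ℓ = 2·n! − 1 is odd, so reversing a walk does not change the parity of its length.
    ℓ : ℕ
    ℓ = suc (pred (n !) * 2)

    undo : ∀ X c → IsArrangement k c → Walk (X · c) X ℓ
    undo X c c-arr = subst (λ Y → Walk (X · c) Y ℓ) back (repeat ℓ (X · c))
      where
      repeat : ∀ m Y → Walk Y (iterate (_· c) Y m) m
      repeat zero    Y = done
      repeat (suc m) Y = step c c-arr (repeat m (Y · c))
      1+ℓ≡2*n! : suc ℓ ≡ 2 * n !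
      1+ℓ≡2*n! = trans (cong (_* 2) (suc-pred (n !) {{n !≢0}})) (*-comm (n !) 2)
      back : iterate (_· c) (X · c) ℓ ≡ X
      back = trans (cong (iterate (_· c) X) 1+ℓ≡2*n!) (iterate-*-fixed (_· c) {d = n !} (iterate-·-n! X c) 2)

    reverse : ∀ {X Y t} → Walk X Y t → Walk Y X (t * ℓ)
    reverse done = done
    reverse {X} (step {t = t} c c-arr w) = subst (Walk _ X) (+-comm (t * ℓ) ℓ) (reverse w ++ʷ undo X c c-arr)

module AscendingChains where

  open FiniteSums
  open import Data.List using (List; filter; length)
  open import Data.List.Membership.Propositional using (_∈_; find; lose)
  open import Data.List.Properties using (length-filter)
  open import Data.List.Relation.Unary.Any using (any?)
  open import Data.Nat using (ℕ; zero; suc; _+_; _∸_; _≤_; _<_; z≤n; s≤s)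
  open import Data.Nat.Properties
  open import Data.Product using (Σ-syntax; _×_; _,_)
  open import Data.Sum using (_⊎_; inj₁; inj₂)
  open import Relation.Binary.PropositionalEquality
  open import Relation.Nullary using (Dec; yes; no; ¬?; _×-dec_; contradiction)

  module Stabilisation {a p} {A : Set a} (xs : List A) (∈-xs : ∀ x → x ∈ xs)
    (P : ℕ → A → Set p) (P? : ∀ i x → Dec (P i x))
    (P-mono : ∀ i {x} → P i x → P (suc i) x)
    (P-steady : ∀ i → (∀ {x} → P (suc i) x → P i x) → ∀ {x} → P (suc (suc i)) x → P (suc i) x) where

    Steady : ℕ → Set _
    Steady i = ∀ {x} → P (suc i) x → P i x

    size : ℕ → ℕ
    size i = length (filter (P? i) xs)

    steady-or-grows : ∀ i → Steady i ⊎ size i < size (suc i)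
    steady-or-grows i with any? (λ x → P? (suc i) x ×-dec ¬? (P? i x)) xs
    ... | no ¬new = inj₁ λ {x} pₓ → decide x pₓ (P? i x)
      where
      decide : ∀ x → P (suc i) x → Dec (P i x) → P i x
      decide x pₓ (yes pᵢₓ) = pᵢₓ
      decide x pₓ (no ¬pᵢₓ) = contradiction (lose (∈-xs x) (pₓ , ¬pᵢₓ)) ¬new
    ... | yes new with find new
    ...   | x , x∈ , pₓ , ¬pᵢₓ = inj₂ (begin-strict
      size i                       ≡⟨ length-filter≡∑𝟙 (P? i) xs ⟩
      ∑[ y ∈ xs ] 𝟙 (P? i y)       <⟨ ∑-mono-< xs 𝟙-mono x∈ 𝟙-new ⟩
      ∑[ y ∈ xs ] 𝟙 (P? (suc i) y) ≡⟨ length-filter≡∑𝟙 (P? (suc i)) xs ⟨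
      size (suc i)                 ∎)
      where
      open ≤-Reasoning
      𝟙-new : 𝟙 (P? i x) < 𝟙 (P? (suc i) x)
      𝟙-new = subst₂ _<_ (sym (𝟙-no (P? i x) ¬pᵢₓ)) (sym (𝟙-yes (P? (suc i) x) pₓ)) ≤-refl
      𝟙-mono : ∀ y → 𝟙 (P? i y) ≤ 𝟙 (P? (suc i) y)
      𝟙-mono y with P? i y
      ... | yes pᵢy = ≤-reflexive (sym (𝟙-yes (P? (suc i) y) (P-mono i pᵢy)))
      ... | no _    = z≤n

    steady-within : ∀ m → (Σ[ i ∈ ℕ ] i ≤ m × Steady i) ⊎ m ≤ size m
    steady-within zero = inj₂ z≤n
    steady-within (suc m) with steady-within m
    ... | inj₁ (i , i≤m , st) = inj₁ (i , m≤n⇒m≤1+n i≤m , st)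
    ... | inj₂ m≤size with steady-or-grows m
    ...   | inj₁ st    = inj₁ (m , n≤1+n m , st)
    ...   | inj₂ grows = inj₂ (≤-trans (s≤s m≤size) grows)

    N : ℕ
    N = suc (length xs)

    steady-index : Σ[ i ∈ ℕ ] i ≤ N × Steady i
    steady-index with steady-within N
    ... | inj₁ found = found
    ... | inj₂ N≤size = contradiction (≤-trans N≤size (length-filter (P? N) xs)) (n≮n (length xs))

    ascend : ∀ d {i x} → P i x → P (d + i) x
    ascend zero    pᵢ = pᵢ
    ascend (suc d) pᵢ = P-mono _ (ascend d pᵢ)

    steady-forever : ∀ {i} → Steady i → ∀ d → Steady (d + i)
    steady-forever st zero    = st
    steady-forever st (suc d) = P-steady _ (steady-forever st d)

    descend : ∀ {i} → Steady i → ∀ d {x} → P (d + i) x → P i x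
    descend st zero    p = p
    descend st (suc d) p = descend st d (steady-forever st d p)

    stabilises : ∀ j {x} → P j x → P N x
    stabilises j {x} pⱼ with steady-index
    ... | i , i≤N , st = subst (λ m → P m x) (m∸n+n≡m i≤N) (ascend (N ∸ i) (to-i (≤-total i j)))
      where
      to-i : i ≤ j ⊎ j ≤ i → P i x
      to-i (inj₁ i≤j) = descend st (j ∸ i) (subst (λ m → P m x) (sym (m∸n+n≡m i≤j)) pⱼ)
      to-i (inj₂ j≤i) = subst (λ m → P m x) (m∸n+n≡m j≤i) (ascend (i ∸ j) pⱼ)

module Parity where

  open import Data.Nat using (ℕ; zero; suc; _+_; _*_)
  open import Data.Nat.Properties using (+-suc)
  open import Data.Product using (Σ-syntax)
  open import Relation.Binary.PropositionalEquality

  data ParityView : ℕ → Set where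
    even : ∀ h → ParityView (h * 2)
    odd  : ∀ h → ParityView (suc (h * 2))

  parityView : ∀ t → ParityView t
  parityView zero          = even 0
  parityView (suc zero)    = odd 0
  parityView (suc (suc t)) with parityView t
  ... | even h = even (suc h)
  ... | odd h  = odd (suc h)

  Odd : ℕ → Set
  Odd t = Σ[ h ∈ ℕ ] t ≡ suc (h * 2)

  +2-inside : ∀ p t → p + (2 + t) ≡ 2 + (p + t)
  +2-inside p t = trans (+-suc p (suc t)) (cong suc (+-suc p t))

module Mixing where

  open FiniteSums
  open VectorEnumeration
  open WalkCounting
  open Quasigroups
  open AscendingChains
  open Parity
  open import Defs
  open import Data.Fin using (Fin)
  open import Data.List using (length)
  open import Data.Nat using (ℕ; zero; suc; _+_; _*_; _∸_; _^_; _≤_; _<_; _!; pred; z≤n)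
  open import Data.Nat.Properties
  open import Data.Nat.Tactic.RingSolver using (solve-∀)
  open import Data.Product using (Σ-syntax; _×_; _,_; proj₁; proj₂)
  open import Data.Sum using (_⊎_; inj₁; inj₂)
  open import Relation.Binary.PropositionalEquality
  open import Relation.Nullary using (Dec; yes; no)
  open import Function using (_∘_)

  module Minorisation {n} (_⋆_ : Fin n → Fin n → Fin n) (Qg : IsQuasigroup _⋆_) (k : ℕ) (0<n : 0 < n) where

    open Walks _⋆_ k
    open QuasigroupWalks _⋆_ Qg k 0<n

    opaque
      N : ℕ
      N = suc (length states)

    opaque
      unfolding N
      reachable-stable : ∀ p h {Z} → Reachable (p + h * 2) Z → Reachable (p + N * 2) Z
      reachable-stable p h = stabilises h
        where
        mono : ∀ i {Z} → Reachable (p + i * 2) Z → Reachable (p + suc i * 2) Z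
        mono i {Z} reach = subst (λ t → Reachable t Z) (sym (+2-inside p (i * 2))) (reachable-+2 reach)
        steady : ∀ i → (∀ {Z} → Reachable (p + suc i * 2) Z → Reachable (p + i * 2) Z) →
                 ∀ {Z} → Reachable (p + suc (suc i) * 2) Z → Reachable (p + suc i * 2) Z
        steady i st {Z} (c , c-arr , w)
          with splitʷ (p + suc i * 2) {2} (subst (Walk c Z) (trans (+2-inside p _) (+-comm 2 _)) w)
        ... | Y , w₁ , w₂ = subst (λ t → Reachable t Z) (trans (+-comm _ 2) (sym (+2-inside p _))) (reachable-++ (st (c , c-arr , w₁)) w₂)
        open Stabilisation states ∈-allVecs (λ i → Reachable (p + i * 2)) (λ i → reachable? (p + i * 2)) mono steady

    OddLoop : Set
    OddLoop = Walk Eᵏ Eᵏ (suc (N * 2))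

    E-reachable-even⇒OddLoop : ∀ h → Reachable (h * 2) Eᵏ → OddLoop
    E-reachable-even⇒OddLoop h reach with reachable-stable 0 h reach
    ... | c , c-arr , w = walk-from-E c c-arr ++ʷ w

    -- Unless E lies on a closed walk of odd length, a state reachable at time t has walks to E only of
    -- lengths of the opposite parity to t; as r is even, only odd times qualify then.
    AdmissibleTime : ℕ → Set
    AdmissibleTime t = Odd t ⊎ OddLoop

    Admissible : State → Set
    Admissible Z = Σ[ t ∈ ℕ ] AdmissibleTime t × Reachable t Z

    -- The walks to E built below have lengths (2N + 1)ℓ + 1 + 2N and 2Nℓ + 1 + (2N + 1) + 2(n! − 1),
    -- which are both r.
    K : ℕ
    K = N * ℓ + N + suc (pred (n !))

    r : ℕ
    r = K * 2

    walk-to-E-from-odd : ∀ h {Z} → Reachable (suc (h * 2)) Z → Walk Z Eᵏ r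
    walk-to-E-from-odd h reach with reachable-stable 1 h reach
    ... | c , c-arr , w = subst (Walk _ Eᵏ) (length≡r N (pred (n !))) (reverse w ++ʷ walk-to-E c c-arr ++ʷ cycles N)
      where
      length≡r : ∀ N g → suc (N * 2) * suc (g * 2) + (1 + N * 2) ≡ (N * suc (g * 2) + N + suc g) * 2
      length≡r = solve-∀

    walk-to-E-from-even : OddLoop → ∀ h {Z} → Reachable (h * 2) Z → Walk Z Eᵏ r
    walk-to-E-from-even loop h reach with reachable-stable 0 h reach
    ... | c , c-arr , w = subst (Walk _ Eᵏ) (length≡r N (pred (n !))) (reverse w ++ʷ walk-to-E c c-arr ++ʷ loop ++ʷ cycles (pred (n !)))
      where
      length≡r : ∀ N g → N * 2 * suc (g * 2) + (1 + (suc (N * 2) + g * 2)) ≡ (N * suc (g * 2) + N + suc g) * 2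
      length≡r = solve-∀

    admissible⇒walk-to-E : ∀ {Z} → Admissible Z → Walk Z Eᵏ r
    admissible⇒walk-to-E (t , inj₁ (h , refl) , reach) = walk-to-E-from-odd h reach
    admissible⇒walk-to-E (t , inj₂ loop , reach) with parityView t
    ... | even h = walk-to-E-from-even loop h reach
    ... | odd h  = walk-to-E-from-odd h reach

    admissible-++ : ∀ {Z U} → Admissible Z → Walk Z U r → Admissible U
    admissible-++ (t , adm , reach) w = t + r , shift adm , reachable-++ reach w
      where
      shift : AdmissibleTime t → AdmissibleTime (t + r)
      shift (inj₁ (h , refl)) = inj₁ (h + K , cong suc (sym (*-distribʳ-+ 2 h K)))
      shift (inj₂ loop)       = inj₂ loop

    E-reachable⇒admissibleTime : ∀ a J → Reachable (a + J * 2) Eᵏ → AdmissibleTime a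
    E-reachable⇒admissibleTime a J reach with parityView a
    ... | odd h  = inj₁ (h , refl)
    ... | even h = inj₂ (E-reachable-even⇒OddLoop (h + J) (subst (λ t → Reachable t Eᵏ) (sym (*-distribʳ-+ 2 h J)) reach))

    walksᴱ : ℕ → State → ℕ
    walksᴱ s Z = walks s Z Eᵏ

    excess : State → State → ℕ
    excess Z U = walks r Z U ∸ 𝟙 (Eᵏ ≟ᵥ U)

    walks-r≡𝟙+excess : ∀ {Z} → Admissible Z → ∀ U → walks r Z U ≡ 𝟙 (Eᵏ ≟ᵥ U) + excess Z U
    walks-r≡𝟙+excess adm U = sym (m+[n∸m]≡n (𝟙≤walks (Eᵏ ≟ᵥ U)))
      where
      𝟙≤walks : (E≟U : Dec (Eᵏ ≡ U)) → 𝟙 E≟U ≤ walks r _ U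
      𝟙≤walks (yes refl) = walk⇒1≤walks (admissible⇒walk-to-E adm)
      𝟙≤walks (no _)     = z≤n

    ∑-excess : ∀ {Z} → Admissible Z → ∑[ U ∈ states ] excess Z U ≡ D ^ r ∸ 1
    ∑-excess {Z} adm = begin
      ∑[ U ∈ states ] excess Z U                                   ≡⟨ m+n∸m≡n 1 _ ⟨
      1 + ∑[ U ∈ states ] excess Z U ∸ 1                           ≡⟨ cong (λ m → m + ∑[ U ∈ states ] excess Z U ∸ 1) (∑-allVecs-𝟙 Eᵏ) ⟨
      ∑[ U ∈ states ] 𝟙 (Eᵏ ≟ᵥ U) + ∑[ U ∈ states ] excess Z U ∸ 1 ≡⟨ cong (_∸ 1) (∑-distrib-+ states (λ U → 𝟙 (Eᵏ ≟ᵥ U)) (excess Z)) ⟨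
      ∑[ U ∈ states ] (𝟙 (Eᵏ ≟ᵥ U) + excess Z U) ∸ 1               ≡⟨ cong (_∸ 1) (∑-cong states (walks-r≡𝟙+excess adm)) ⟨
      ∑[ U ∈ states ] walks r Z U ∸ 1                              ≡⟨ cong (_∸ 1) (∑-walks r Z) ⟩
      D ^ r ∸ 1                                                    ∎
      where open ≡-Reasoning

    walksᴱ-via-excess : ∀ {Z} → Admissible Z → ∀ s →
                        walksᴱ (r + s) Z ≡ walksᴱ s Eᵏ + ∑[ U ∈ states ] (excess Z U * walksᴱ s U)
    walksᴱ-via-excess {Z} adm s = begin
      walksᴱ (r + s) Z
        ≡⟨ walks-+ r s Z Eᵏ ⟩
      ∑[ U ∈ states ] (walks r Z U * walksᴱ s U)
        ≡⟨ ∑-cong states (λ U → cong (_* walksᴱ s U) (walks-r≡𝟙+excess adm U)) ⟩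
      ∑[ U ∈ states ] ((𝟙 (Eᵏ ≟ᵥ U) + excess Z U) * walksᴱ s U)
        ≡⟨ ∑-cong states (λ U → *-distribʳ-+ (walksᴱ s U) (𝟙 (Eᵏ ≟ᵥ U)) (excess Z U)) ⟩
      ∑[ U ∈ states ] (𝟙 (Eᵏ ≟ᵥ U) * walksᴱ s U + excess Z U * walksᴱ s U)
        ≡⟨ ∑-distrib-+ states _ _ ⟩
      ∑[ U ∈ states ] (𝟙 (Eᵏ ≟ᵥ U) * walksᴱ s U) + ∑[ U ∈ states ] (excess Z U * walksᴱ s U)
        ≡⟨ cong (_+ ∑[ U ∈ states ] (excess Z U * walksᴱ s U)) (∑-allVecs-sift Eᵏ (walksᴱ s)) ⟩
      walksᴱ s Eᵏ + ∑[ U ∈ states ] (excess Z U * walksᴱ s U)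
        ∎
      where open ≡-Reasoning

    excess-admissible : ∀ {Z U} → Admissible Z → 1 ≤ excess Z U → Admissible U
    excess-admissible {Z} {U} adm 1≤e =
      admissible-++ adm (1≤walks⇒walk r Z U (≤-trans 1≤e (m∸n≤m (walks r Z U) (𝟙 (Eᵏ ≟ᵥ U)))))

    Bounded : ℕ → ℕ → ℕ → Set
    Bounded s lo Θ = ∀ Z → Admissible Z → lo ≤ walksᴱ s Z × walksᴱ s Z ≤ lo + Θ

    -- Doeblin's coupling: the r-step walks from every admissible Z include one ending in E, which
    -- contributes the same walksᴱ s Eᵏ for all Z, so only the other D ^ r ∸ 1 walks spread the counts.
    bounded-step : ∀ {s lo Θ} → Bounded s lo Θ → Bounded (r + s) (walksᴱ s Eᵏ + (D ^ r ∸ 1) * lo) ((D ^ r ∸ 1) * Θ)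
    bounded-step {s} {lo} {Θ} bnd Z adm = lower , upper
      where
      ∑excess-weighted-≥ = ∑-weighted-≥ states (excess Z) (walksᴱ s) (λ U → proj₁ ∘ bnd U ∘ excess-admissible adm)
      ∑excess-weighted-≤ = ∑-weighted-≤ states (excess Z) (walksᴱ s) (λ U → proj₂ ∘ bnd U ∘ excess-admissible adm)
      lower : walksᴱ s Eᵏ + (D ^ r ∸ 1) * lo ≤ walksᴱ (r + s) Z
      lower = begin
        walksᴱ s Eᵏ + (D ^ r ∸ 1) * lo                          ≡⟨ cong (λ m → walksᴱ s Eᵏ + m * lo) (∑-excess adm) ⟨
        walksᴱ s Eᵏ + (∑[ U ∈ states ] excess Z U) * lo         ≤⟨ +-monoʳ-≤ (walksᴱ s Eᵏ) ∑excess-weighted-≥ ⟩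
        walksᴱ s Eᵏ + ∑[ U ∈ states ] (excess Z U * walksᴱ s U) ≡⟨ walksᴱ-via-excess adm s ⟨
        walksᴱ (r + s) Z                                        ∎
        where open ≤-Reasoning
      upper : walksᴱ (r + s) Z ≤ walksᴱ s Eᵏ + (D ^ r ∸ 1) * lo + (D ^ r ∸ 1) * Θ
      upper = begin
        walksᴱ (r + s) Z                                        ≡⟨ walksᴱ-via-excess adm s ⟩
        walksᴱ s Eᵏ + ∑[ U ∈ states ] (excess Z U * walksᴱ s U) ≤⟨ +-monoʳ-≤ (walksᴱ s Eᵏ) ∑excess-weighted-≤ ⟩
        walksᴱ s Eᵏ + (∑[ U ∈ states ] excess Z U) * (lo + Θ)   ≡⟨ cong (λ m → walksᴱ s Eᵏ + m * (lo + Θ)) (∑-excess adm) ⟩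
        walksᴱ s Eᵏ + (D ^ r ∸ 1) * (lo + Θ)                    ≡⟨ cong (walksᴱ s Eᵏ +_) (*-distribˡ-+ (D ^ r ∸ 1) lo Θ) ⟩
        walksᴱ s Eᵏ + ((D ^ r ∸ 1) * lo + (D ^ r ∸ 1) * Θ)      ≡⟨ +-assoc (walksᴱ s Eᵏ) _ _ ⟨
        walksᴱ s Eᵏ + (D ^ r ∸ 1) * lo + (D ^ r ∸ 1) * Θ        ∎
        where open ≤-Reasoning

    bounded-after : ∀ j → Σ[ lo ∈ ℕ ] Bounded (j * r) lo ((D ^ r ∸ 1) ^ j)
    bounded-after zero    = 0 , λ Z _ → z≤n , subst (_≤ 1) (sym (walks-zero Z Eᵏ)) (𝟙≤1 (Z ≟ᵥ Eᵏ))
    bounded-after (suc j) = let lo , b = bounded-after j in _ , bounded-step b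

    reachable⇒admissible : ∀ {a} → AdmissibleTime a → ∀ Z → 1 ≤ l _⋆_ k Z (suc a) → Admissible Z
    reachable⇒admissible {a} adm-a Z 1≤l = a , adm-a , 1≤l⇒reachable a Z 1≤l

    l-≥ : ∀ {a s lo} → AdmissibleTime a → (∀ Z → Admissible Z → lo ≤ walksᴱ s Z) →
          D ^ suc a * lo ≤ l _⋆_ k Eᵏ (suc (a + s))
    l-≥ {a} {s} {lo} adm-a lo≤ = begin
      D ^ suc a * lo                                   ≡⟨ cong (_* lo) (∑-l a) ⟨
      (∑[ Z ∈ states ] l _⋆_ k Z (suc a)) * lo         ≤⟨ ∑-weighted-≥ states _ (walksᴱ s) (λ Z → lo≤ Z ∘ reachable⇒admissible adm-a Z) ⟩
      ∑[ Z ∈ states ] (l _⋆_ k Z (suc a) * walksᴱ s Z) ≡⟨ l-+ a s Eᵏ ⟨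
      l _⋆_ k Eᵏ (suc (a + s))                         ∎
      where open ≤-Reasoning

    l-≤ : ∀ {a s hi} → AdmissibleTime a → (∀ Z → Admissible Z → walksᴱ s Z ≤ hi) →
          l _⋆_ k Eᵏ (suc (a + s)) ≤ D ^ suc a * hi
    l-≤ {a} {s} {hi} adm-a ≤hi = begin
      l _⋆_ k Eᵏ (suc (a + s))                         ≡⟨ l-+ a s Eᵏ ⟩
      ∑[ Z ∈ states ] (l _⋆_ k Z (suc a) * walksᴱ s Z) ≤⟨ ∑-weighted-≤ states _ (walksᴱ s) (λ Z → ≤hi Z ∘ reachable⇒admissible adm-a Z) ⟩
      (∑[ Z ∈ states ] l _⋆_ k Z (suc a)) * hi         ≡⟨ cong (_* hi) (∑-l a) ⟩
      D ^ suc a * hi                                   ∎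
      where open ≤-Reasoning

    l-lower : ∀ {a} → AdmissibleTime a → D ^ suc a ≤ l _⋆_ k Eᵏ (suc (a + r))
    l-lower {a} adm-a = subst (_≤ l _⋆_ k Eᵏ (suc (a + r))) (*-identityʳ (D ^ suc a))
      (l-≥ {s = r} adm-a (λ Z adm → walk⇒1≤walks (admissible⇒walk-to-E adm)))

module RationalFacts where

  open import Algebra.Bundles using (CommutativeRing)
  open import Data.Integer as ℤ using (+_)
  import Data.Integer.Properties as ℤ
  import Data.Integer.Tactic.RingSolver as ℤ-Solver
  open import Data.Nat as ℕ using (ℕ; zero; suc; z≤n; s≤s)
  import Data.Nat.Properties as ℕ
  import Data.Nat.Tactic.RingSolver as ℕ-Solver
  import Data.Nat.Coprimality as Coprime
  open import Data.Nat.GCD using (gcd; gcd[m,n]≢0)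
  open import Data.Product using (Σ-syntax; _×_; _,_)
  open import Data.Rational as ℚ using (ℚ; mkℚ; _/_; 0ℚ; 1ℚ; _+_; _*_; _-_; -_; ∣_∣; _≤_; _<_; ↥_; ↧_; *≡*; *≤*; *<*; NonNegative)
  open import Data.Rational.Properties
  open import Data.Rational.Solver using (module +-*-Solver)
  open import Data.Sum using (_⊎_; inj₁; inj₂)
  open import Relation.Binary.PropositionalEquality
  open import Defs using (powℚ)
  open import Relation.Nullary using (contradiction)

  open import Algebra.Properties.CommutativeSemiring.Exp (CommutativeRing.commutativeSemiring +-*-commutativeRing)
    public using (_^_; ^-homo-*; ^-distrib-*)

  /-≡ : ∀ a d b e .{{_ : ℕ.NonZero d}} .{{_ : ℕ.NonZero e}} → a ℕ.* e ≡ b ℕ.* d → + a / d ≡ + b / e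
  /-≡ a d b e ae≡bd = ≃⇒≡ (*≡* (ℤ.*-cancelʳ-≡ _ _ g₁ {{g₁≢0}} (ℤ.*-cancelʳ-≡ _ _ g₂ {{g₂≢0}} cross)))
    where
    p = + a / d
    q = + b / e
    g₁ = + gcd a d
    g₂ = + gcd b e
    g₁≢0 : ℕ.NonZero (gcd a d)
    g₁≢0 = ℕ.≢-nonZero (gcd[m,n]≢0 a d (inj₂ (ℕ.≢-nonZero⁻¹ d)))
    g₂≢0 : ℕ.NonZero (gcd b e)
    g₂≢0 = ℕ.≢-nonZero (gcd[m,n]≢0 b e (inj₂ (ℕ.≢-nonZero⁻¹ e)))
    regroup : ∀ w x y z → ((w ℤ.* x) ℤ.* y) ℤ.* z ≡ (w ℤ.* y) ℤ.* (x ℤ.* z)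
    regroup = ℤ-Solver.solve-∀
    regroup′ : ∀ w x y z → ((w ℤ.* x) ℤ.* y) ℤ.* z ≡ (w ℤ.* z) ℤ.* (x ℤ.* y)
    regroup′ = ℤ-Solver.solve-∀
    cross : ((↥ p ℤ.* ↧ q) ℤ.* g₁) ℤ.* g₂ ≡ ((↥ q ℤ.* ↧ p) ℤ.* g₁) ℤ.* g₂
    cross = begin
      ((↥ p ℤ.* ↧ q) ℤ.* g₁) ℤ.* g₂ ≡⟨ regroup (↥ p) (↧ q) g₁ g₂ ⟩
      (↥ p ℤ.* g₁) ℤ.* (↧ q ℤ.* g₂) ≡⟨ cong₂ ℤ._*_ (↥-/ (+ a) d) (↧-/ (+ b) e) ⟩
      + a ℤ.* + e                   ≡⟨ ℤ.pos-* a e ⟨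
      + (a ℕ.* e)                   ≡⟨ cong +_ ae≡bd ⟩
      + (b ℕ.* d)                   ≡⟨ ℤ.pos-* b d ⟩
      + b ℤ.* + d                   ≡⟨ cong₂ ℤ._*_ (↥-/ (+ b) e) (↧-/ (+ a) d) ⟨
      (↥ q ℤ.* g₂) ℤ.* (↧ p ℤ.* g₁) ≡⟨ regroup′ (↥ q) (↧ p) g₁ g₂ ⟨
      ((↥ q ℤ.* ↧ p) ℤ.* g₁) ℤ.* g₂ ∎
      where open ≡-Reasoning

  toℚ : ℕ → ℚ
  toℚ a = + a / 1

  toℚ≡mkℚ : ∀ a → toℚ a ≡ mkℚ (+ a) 0 (Coprime.sym (Coprime.1-coprimeTo a))
  toℚ≡mkℚ a = normalize-coprime (Coprime.sym (Coprime.1-coprimeTo a))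

  toℚ-+ : ∀ a b → toℚ (a ℕ.+ b) ≡ toℚ a + toℚ b
  toℚ-+ a b rewrite toℚ≡mkℚ a | toℚ≡mkℚ b =
    cong (_/ 1) (trans (ℤ.pos-+ a b) (sym (cong₂ ℤ._+_ (ℤ.*-identityʳ (+ a)) (ℤ.*-identityʳ (+ b)))))

  toℚ-* : ∀ a b → toℚ (a ℕ.* b) ≡ toℚ a * toℚ b
  toℚ-* a b rewrite toℚ≡mkℚ a | toℚ≡mkℚ b = cong (_/ 1) (ℤ.pos-* a b)

  toℚ-^ : ∀ a j → toℚ (a ℕ.^ j) ≡ toℚ a ^ j
  toℚ-^ a zero    = refl
  toℚ-^ a (suc j) = trans (toℚ-* a (a ℕ.^ j)) (cong (toℚ a *_) (toℚ-^ a j))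

  toℚ-mono-≤ : ∀ {a b} → a ℕ.≤ b → toℚ a ≤ toℚ b
  toℚ-mono-≤ {a} {b} a≤b rewrite toℚ≡mkℚ a | toℚ≡mkℚ b =
    *≤* (subst₂ ℤ._≤_ (sym (ℤ.*-identityʳ (+ a))) (sym (ℤ.*-identityʳ (+ b))) (ℤ.+≤+ a≤b))

  toℚ-mono-< : ∀ {a b} → a ℕ.< b → toℚ a < toℚ b
  toℚ-mono-< {a} {b} a<b rewrite toℚ≡mkℚ a | toℚ≡mkℚ b =
    *<* (subst₂ ℤ._<_ (sym (ℤ.*-identityʳ (+ a))) (sym (ℤ.*-identityʳ (+ b))) (ℤ.+<+ a<b))

  toℚ-*-/ : ∀ a c F .{{_ : ℕ.NonZero F}} → a ℕ.* c ≡ F → toℚ a * (+ c / F) ≡ 1ℚ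
  toℚ-*-/ zero    c F 0≡F = contradiction (sym 0≡F) (ℕ.≢-nonZero⁻¹ F)
  toℚ-*-/ (suc a) c F a*c≡F = begin
    toℚ (suc a) * (+ c / F)               ≡⟨ cong₂ _*_ (toℚ≡mkℚ (suc a)) (/-≡ c F 1 (suc a) c*a≡F) ⟩
    mkℚ (+ suc a) 0 a⊥1 * (+ 1 / suc a)   ≡⟨ cong (mkℚ (+ suc a) 0 a⊥1 *_) (normalize-coprime (Coprime.1-coprimeTo (suc a))) ⟩
    mkℚ (+ suc a) 0 a⊥1 * mkℚ (+ 1) a 1⊥a ≡⟨⟩
    (+ suc a ℤ.* + 1) / (1 ℕ.* suc a)     ≡⟨ cong (_/ (1 ℕ.* suc a)) (ℤ.pos-* (suc a) 1) ⟨
    + (suc a ℕ.* 1) / (1 ℕ.* suc a)       ≡⟨ /-≡ (suc a ℕ.* 1) (1 ℕ.* suc a) 1 1 (units (suc a)) ⟩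
    1ℚ                                    ∎
    where
    open ≡-Reasoning
    1⊥a = Coprime.1-coprimeTo (suc a)
    a⊥1 = Coprime.sym 1⊥a
    units : ∀ m → m ℕ.* 1 ℕ.* 1 ≡ 1 ℕ.* (1 ℕ.* m)
    units = ℕ-Solver.solve-∀
    c*a≡F : c ℕ.* suc a ≡ 1 ℕ.* F
    c*a≡F = trans (ℕ.*-comm c (suc a)) (trans a*c≡F (sym (ℕ.*-identityˡ F)))

  toℚ-nonNeg : ∀ a → NonNegative (toℚ a)
  toℚ-nonNeg a = normalize-nonNeg a 1

  positive⇒fraction : ∀ ε → 0ℚ < ε → Σ[ N ∈ ℕ ] Σ[ d ∈ ℕ ] 1 ℕ.≤ N × ε * toℚ d ≡ toℚ N
  positive⇒fraction ε@(mkℚ (+ suc N) d-1 _) _ = suc N , suc d-1 , s≤s z≤n , ε*d≡N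
    where
    d = suc d-1
    ε*d≡N : ε * toℚ d ≡ toℚ (suc N)
    ε*d≡N rewrite toℚ≡mkℚ d = begin
      (+ suc N ℤ.* + d) / (d ℕ.* 1) ≡⟨ cong (_/ (d ℕ.* 1)) (ℤ.pos-* (suc N) d) ⟨
      + (suc N ℕ.* d) / (d ℕ.* 1)   ≡⟨ /-≡ (suc N ℕ.* d) (d ℕ.* 1) (suc N) 1 (cross (suc N) d) ⟩
      toℚ (suc N)                   ∎
      where
      open ≡-Reasoning
      cross : ∀ m d → m ℕ.* d ℕ.* 1 ≡ m ℕ.* (d ℕ.* 1)
      cross = ℕ-Solver.solve-∀
  positive⇒fraction (mkℚ (+ zero) _ _) 0<ε with ℚ.positive 0<ε
  ... | ()
  positive⇒fraction (mkℚ ℤ.-[1+ _ ] _ _) 0<ε with ℚ.positive 0<ε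
  ... | ()

  ∣-∣≤-window : ∀ {α θ x y} → α ≤ x → x ≤ α + θ → α ≤ y → y ≤ α + θ → ∣ x - y ∣ ≤ θ
  ∣-∣≤-window {α} {θ} {x} {y} α≤x x≤α+θ α≤y y≤α+θ = bound (∣p∣≡p∨∣p∣≡-p (x - y))
    where
    open +-*-Solver
    α+θ-α≡θ : α + θ - α ≡ θ
    α+θ-α≡θ = solve 2 (λ α θ → (α :+ θ) :- α := θ) refl α θ
    -[x-y]≡y-x : - (x - y) ≡ y - x
    -[x-y]≡y-x = solve 2 (λ x y → :- (x :- y) := y :- x) refl x y
    bound : ∣ x - y ∣ ≡ x - y ⊎ ∣ x - y ∣ ≡ - (x - y) → ∣ x - y ∣ ≤ θ
    bound (inj₁ ∣x-y∣≡x-y) =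
      subst₂ _≤_ (sym ∣x-y∣≡x-y) α+θ-α≡θ (+-mono-≤ x≤α+θ (neg-antimono-≤ α≤y))
    bound (inj₂ ∣x-y∣≡y-x) =
      subst₂ _≤_ (sym (trans ∣x-y∣≡y-x -[x-y]≡y-x)) α+θ-α≡θ (+-mono-≤ y≤α+θ (neg-antimono-≤ α≤x))

  bernoulli : ∀ p j → p ℕ.^ j ℕ.* (p ℕ.+ j) ℕ.≤ p ℕ.* suc p ℕ.^ j
  bernoulli p zero    = ℕ.≤-reflexive (base p)
    where
    base : ∀ p → 1 ℕ.* (p ℕ.+ 0) ≡ p ℕ.* 1
    base = ℕ-Solver.solve-∀
  bernoulli p (suc j) = begin
    p ℕ.^ suc j ℕ.* (p ℕ.+ suc j)                   ≤⟨ ℕ.m≤m+n _ (p ℕ.^ j ℕ.* j) ⟩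
    p ℕ.^ suc j ℕ.* (p ℕ.+ suc j) ℕ.+ p ℕ.^ j ℕ.* j ≡⟨ expand p j (p ℕ.^ j) ⟩
    p ℕ.^ j ℕ.* (p ℕ.+ j) ℕ.* suc p                 ≤⟨ ℕ.*-monoˡ-≤ (suc p) (bernoulli p j) ⟩
    p ℕ.* suc p ℕ.^ j ℕ.* suc p                     ≡⟨ regroup p (suc p ℕ.^ j) ⟩
    p ℕ.* suc p ℕ.^ suc j                           ∎
    where
    open ℕ.≤-Reasoning
    expand : ∀ p j x → p ℕ.* x ℕ.* (p ℕ.+ suc j) ℕ.+ x ℕ.* j ≡ x ℕ.* (p ℕ.+ j) ℕ.* suc p
    expand = ℕ-Solver.solve-∀
    regroup : ∀ p y → p ℕ.* y ℕ.* suc p ≡ p ℕ.* (suc p ℕ.* y)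
    regroup = ℕ-Solver.solve-∀

  geometric-decay : ∀ p d → d ℕ.* p ℕ.^ (d ℕ.* suc p) ℕ.< suc p ℕ.^ (d ℕ.* suc p)
  geometric-decay p d = ℕ.*-cancelˡ-< (suc p) _ _ (begin-strict
    suc p ℕ.* (d ℕ.* p ℕ.^ j) ≡⟨ regroup p d (p ℕ.^ j) ⟩
    p ℕ.^ j ℕ.* j             ≤⟨ ℕ.*-monoʳ-≤ (p ℕ.^ j) (ℕ.m≤n+m j p) ⟩
    p ℕ.^ j ℕ.* (p ℕ.+ j)     ≤⟨ bernoulli p j ⟩
    p ℕ.* suc p ℕ.^ j         <⟨ ℕ.*-monoˡ-< (suc p ℕ.^ j) {{ℕ.m^n≢0 (suc p) j}} (ℕ.n<1+n p) ⟩
    suc p ℕ.* suc p ℕ.^ j     ∎)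
    where
    open ℕ.≤-Reasoning
    j = d ℕ.* suc p
    regroup : ∀ p d x → suc p ℕ.* (d ℕ.* x) ≡ x ℕ.* (d ℕ.* suc p)
    regroup = ℕ-Solver.solve-∀

  eventually-small : ∀ p {ε} → 0ℚ < ε → Σ[ j ∈ ℕ ] toℚ (p ℕ.^ j) < ε * toℚ (suc p ℕ.^ j)
  eventually-small p {ε} 0<ε with positive⇒fraction ε 0<ε
  ... | N , d , 1≤N , ε*d≡N = j , *-cancelʳ-<-nonNeg (toℚ d) {{toℚ-nonNeg d}} (begin-strict
    toℚ (p ℕ.^ j) * toℚ d         ≡⟨ toℚ-* (p ℕ.^ j) d ⟨
    toℚ (p ℕ.^ j ℕ.* d)           ≡⟨ cong toℚ (ℕ.*-comm (p ℕ.^ j) d) ⟩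
    toℚ (d ℕ.* p ℕ.^ j)           <⟨ toℚ-mono-< (geometric-decay p d) ⟩
    toℚ (suc p ℕ.^ j)             ≤⟨ toℚ-mono-≤ (ℕ.m≤n*m (suc p ℕ.^ j) N {{ℕ.>-nonZero 1≤N}}) ⟩
    toℚ (N ℕ.* suc p ℕ.^ j)       ≡⟨ toℚ-* N (suc p ℕ.^ j) ⟩
    toℚ N * toℚ (suc p ℕ.^ j)     ≡⟨ cong (_* toℚ (suc p ℕ.^ j)) ε*d≡N ⟨
    ε * toℚ d * toℚ (suc p ℕ.^ j) ≡⟨ swap ε (toℚ d) (toℚ (suc p ℕ.^ j)) ⟩
    ε * toℚ (suc p ℕ.^ j) * toℚ d ∎)
    where
    open ≤-Reasoning
    open +-*-Solver
    j = d ℕ.* suc p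
    swap : ∀ x y z → x * y * z ≡ x * z * y
    swap = solve 3 (λ x y z → (x :* y) :* z := (x :* z) :* y) refl

  powℚ≡^ : ∀ {n} q m → powℚ {n} q m ≡ q ^ m
  powℚ≡^     q zero    = refl
  powℚ≡^ {n} q (suc m) = cong (q *_) (powℚ≡^ {n} q m)

module Convergence where

  open FiniteSums
  open WalkCounting
  open Quasigroups
  open Mixing
  open Parity
  open RationalFacts
  open Multinomial using (arrangements-count)
  open import Defs
  open import Data.Fin using (Fin)
  open import Data.Nat as ℕ using (ℕ; zero; suc; _∸_; z≤n; s≤s; _!)
  import Data.Nat.Properties as ℕ
  open import Data.Nat.Divisibility using (_∣_; divides)
  open import Data.Product using (Σ-syntax; _×_; _,_; proj₁; proj₂)
  open import Data.Rational as ℚ using (ℚ; 0ℚ; 1ℚ; _+_; _*_; _-_; ∣_∣; _≤_; _<_; Positive; NonNegative)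
  open import Data.Rational.Properties
  open import Data.Rational.Solver using (module +-*-Solver)
  open import Relation.Binary.PropositionalEquality
  open import Relation.Nullary using (¬_; contradiction)
  open import Function using (_∘_)

  module Limit {n} (_⋆_ : Fin n → Fin n → Fin n) (Qg : IsQuasigroup _⋆_) (k : ℕ) (0<n : 0 ℕ.< n) where

    open Walks _⋆_ k
    open QuasigroupWalks _⋆_ Qg k 0<n
    open Minorisation _⋆_ Qg k 0<n

    ρ : ℚ
    ρ = ratio {n} k

    xᴱ : ℕ → ℚ
    xᴱ = x _⋆_ k Eᵏ

    lᴱ : ℕ → ℕ
    lᴱ = l _⋆_ k Eᵏ

    xᴱ≡ : ∀ m → xᴱ m ≡ toℚ (lᴱ m) * ρ ^ m
    xᴱ≡ m = cong (toℚ (lᴱ m) *_) (powℚ≡^ {n} ρ m)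

    D-nonZero : ℕ.NonZero D
    D-nonZero = ℕ.≢-nonZero λ D≡0 →
      ℕ.<⇒≢ (ℕ.1≤n! (k ℕ.* n)) (trans (cong (ℕ._* (k !) ℕ.^ n) (sym D≡0)) (arrangements-count k))

    ρ-positive : Positive ρ
    ρ-positive = normalize-pos ((k !) ℕ.^ n) ((k ℕ.* n) !) {{(k ℕ.* n) ℕ.!≢0}} {{ℕ.m^n≢0 (k !) n {{k ℕ.!≢0}}}}

    ρ^-positive : ∀ m → Positive (ρ ^ m)
    ρ^-positive zero    = _
    ρ^-positive (suc m) = pos*pos⇒pos ρ {{ρ-positive}} (ρ ^ m) {{ρ^-positive m}}

    ρ^-nonNeg : ∀ m → NonNegative (ρ ^ m)
    ρ^-nonNeg m = pos⇒nonNeg (ρ ^ m) {{ρ^-positive m}}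

    D*ρ≡1 : toℚ D * ρ ≡ 1ℚ
    D*ρ≡1 = toℚ-*-/ D ((k !) ℕ.^ n) ((k ℕ.* n) !) {{(k ℕ.* n) ℕ.!≢0}} (arrangements-count k)

    D^c*ρ^c≡1 : ∀ c → toℚ (D ℕ.^ c) * ρ ^ c ≡ 1ℚ
    D^c*ρ^c≡1 c = begin
      toℚ (D ℕ.^ c) * ρ ^ c ≡⟨ cong (_* ρ ^ c) (toℚ-^ D c) ⟩
      toℚ D ^ c * ρ ^ c     ≡⟨ ^-distrib-* (toℚ D) ρ c ⟨
      (toℚ D * ρ) ^ c       ≡⟨ cong (_^ c) D*ρ≡1 ⟩
      1ℚ ^ c                ≡⟨ 1^ c ⟩
      1ℚ                    ∎
      where
      open ≡-Reasoning
      1^ : ∀ c → 1ℚ ^ c ≡ 1ℚ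
      1^ zero    = refl
      1^ (suc c) = trans (*-identityˡ (1ℚ ^ c)) (1^ c)

    rescale : ∀ c b A → toℚ (D ℕ.^ c ℕ.* A) * ρ ^ (c ℕ.+ b) ≡ toℚ A * ρ ^ b
    rescale c b A = begin
      toℚ (D ℕ.^ c ℕ.* A) * ρ ^ (c ℕ.+ b)     ≡⟨ cong₂ _*_ (toℚ-* (D ℕ.^ c) A) (^-homo-* ρ c b) ⟩
      toℚ (D ℕ.^ c) * toℚ A * (ρ ^ c * ρ ^ b) ≡⟨ interchange (toℚ (D ℕ.^ c)) (toℚ A) (ρ ^ c) (ρ ^ b) ⟩
      toℚ (D ℕ.^ c) * ρ ^ c * (toℚ A * ρ ^ b) ≡⟨ cong (_* (toℚ A * ρ ^ b)) (D^c*ρ^c≡1 c) ⟩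
      1ℚ * (toℚ A * ρ ^ b)                    ≡⟨ *-identityˡ _ ⟩
      toℚ A * ρ ^ b                           ∎
      where
      open ≡-Reasoning
      interchange : ∀ a b c d → a * b * (c * d) ≡ a * c * (b * d)
      interchange = solve 4 (λ a b c d → (a :* b) :* (c :* d) := (a :* c) :* (b :* d)) refl
        where open +-*-Solver

    rescale-≤ : ∀ c b {A L} → D ℕ.^ c ℕ.* A ℕ.≤ L → toℚ A * ρ ^ b ≤ toℚ L * ρ ^ (c ℕ.+ b)
    rescale-≤ c b {A} {L} le = subst (_≤ toℚ L * ρ ^ (c ℕ.+ b)) (rescale c b A)
      (*-monoʳ-≤-nonNeg (ρ ^ (c ℕ.+ b)) {{ρ^-nonNeg (c ℕ.+ b)}} (toℚ-mono-≤ le))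

    rescale-≥ : ∀ c b {A L} → L ℕ.≤ D ℕ.^ c ℕ.* A → toℚ L * ρ ^ (c ℕ.+ b) ≤ toℚ A * ρ ^ b
    rescale-≥ c b {A} {L} le = subst (toℚ L * ρ ^ (c ℕ.+ b) ≤_) (rescale c b A)
      (*-monoʳ-≤-nonNeg (ρ ^ (c ℕ.+ b)) {{ρ^-nonNeg (c ℕ.+ b)}} (toℚ-mono-≤ le))

    1≤l⇒x-positive : ∀ m → 1 ℕ.≤ lᴱ m → 0ℚ < xᴱ m
    1≤l⇒x-positive m 1≤l = subst (0ℚ <_) (sym (xᴱ≡ m)) (positive⁻¹ _ {{l*ρ^m-positive}})
      where
      l*ρ^m-positive : Positive (toℚ (lᴱ m) * ρ ^ m)
      l*ρ^m-positive = pos*pos⇒pos (toℚ (lᴱ m)) {{normalize-pos (lᴱ m) 1 {{_}} {{ℕ.>-nonZero 1≤l}}}} (ρ ^ m) {{ρ^-positive m}}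

    x≢0⇒1≤l : ∀ m → xᴱ m ≢ 0ℚ → 1 ℕ.≤ lᴱ m
    x≢0⇒1≤l m x≢0 = ℕ.n≢0⇒n>0 λ l≡0 → x≢0 (trans (xᴱ≡ m) (trans (cong (λ v → toℚ v * ρ ^ m) l≡0) (*-zeroˡ (ρ ^ m))))

    x-window : ∀ {a s lo Θ} → AdmissibleTime a → Bounded s lo Θ →
               toℚ lo * ρ ^ s ≤ xᴱ (suc (a ℕ.+ s)) × xᴱ (suc (a ℕ.+ s)) ≤ toℚ lo * ρ ^ s + toℚ Θ * ρ ^ s
    x-window {a} {s} {lo} {Θ} adm-a bnd = lower , upper
      where
      lower : toℚ lo * ρ ^ s ≤ xᴱ (suc (a ℕ.+ s))
      lower = subst (toℚ lo * ρ ^ s ≤_) (sym (xᴱ≡ (suc (a ℕ.+ s))))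
        (rescale-≤ (suc a) s (l-≥ adm-a (λ Z → proj₁ ∘ bnd Z)))
      upper : xᴱ (suc (a ℕ.+ s)) ≤ toℚ lo * ρ ^ s + toℚ Θ * ρ ^ s
      upper = subst₂ _≤_ (sym (xᴱ≡ (suc (a ℕ.+ s)))) (trans (cong (_* ρ ^ s) (toℚ-+ lo Θ)) (*-distribʳ-+ (ρ ^ s) (toℚ lo) (toℚ Θ)))
        (rescale-≥ (suc a) s (l-≤ adm-a (λ Z → proj₂ ∘ bnd Z)))

    x-positive-at-even : ∀ m → 1 ℕ.≤ m → 2 ∣ m → 0ℚ < xᴱ m
    x-positive-at-even .(zero ℕ.* 2)  () (divides zero refl)
    x-positive-at-even .(suc h ℕ.* 2) _  (divides (suc h) refl) =
      1≤l⇒x-positive (suc h ℕ.* 2) (reachable⇒1≤l (E-reachable-odd h))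

    x-positive-after-odd : ∀ m′ → ¬ 2 ∣ m′ → 0ℚ < xᴱ m′ → ∀ m → m′ ℕ.≤ m → 0ℚ < xᴱ m
    x-positive-after-odd m′ m′-odd 0<x m m′≤m with parityView m′ | parityView m
    ... | even h′ | _      = contradiction (divides h′ refl) m′-odd
    ... | odd h′  | even h = x-positive-at-even (h ℕ.* 2) (ℕ.≤-trans (s≤s z≤n) m′≤m) (divides h refl)
    ... | odd h′  | odd h  = 1≤l⇒x-positive (suc (h ℕ.* 2)) (reachable⇒1≤l
        (subst (λ t → Reachable t Eᵏ) h′*2+d*2≡h*2 (reachable-++ reach (cycles (h ∸ h′)))))
      where
      reach : Reachable (h′ ℕ.* 2) Eᵏ
      reach = 1≤l⇒reachable (h′ ℕ.* 2) Eᵏ (x≢0⇒1≤l (suc (h′ ℕ.* 2)) (≢-sym (<⇒≢ 0<x)))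
      h′≤h : h′ ℕ.≤ h
      h′≤h = ℕ.*-cancelʳ-≤ h′ h 2 (ℕ.≤-pred m′≤m)
      h′*2+d*2≡h*2 : h′ ℕ.* 2 ℕ.+ (h ∸ h′) ℕ.* 2 ≡ h ℕ.* 2
      h′*2+d*2≡h*2 = trans (sym (ℕ.*-distribʳ-+ 2 h′ (h ∸ h′))) (cong (ℕ._* 2) (ℕ.m+[n∸m]≡n h′≤h))

    x≢0⇒admissibleTime : ∀ a J → xᴱ (suc (a ℕ.+ J ℕ.* 2)) ≢ 0ℚ → AdmissibleTime a
    x≢0⇒admissibleTime a J x≢0 = E-reachable⇒admissibleTime a J (1≤l⇒reachable (a ℕ.+ J ℕ.* 2) Eᵏ (x≢0⇒1≤l _ x≢0))

    x-bounded-below : ∀ m → suc r ℕ.≤ m → xᴱ m ≢ 0ℚ → ρ ^ r ≤ xᴱ m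
    x-bounded-below (suc t) (s≤s r≤t) x≢0 = subst (λ m → ρ ^ r ≤ xᴱ (suc m)) (ℕ.m∸n+n≡m r≤t) (begin
      ρ ^ r                                        ≡⟨ *-identityˡ (ρ ^ r) ⟨
      toℚ 1 * ρ ^ r                                ≤⟨ rescale-≤ (suc a) r (ℕ.≤-trans (ℕ.≤-reflexive (ℕ.*-identityʳ _)) (l-lower adm-a)) ⟩
      toℚ (lᴱ (suc (a ℕ.+ r))) * ρ ^ (suc a ℕ.+ r) ≡⟨ xᴱ≡ (suc (a ℕ.+ r)) ⟨
      xᴱ (suc (a ℕ.+ r))                           ∎)
      where
      open ≤-Reasoning
      a = t ∸ r
      adm-a : AdmissibleTime a
      adm-a = x≢0⇒admissibleTime a K (subst (λ m → xᴱ (suc m) ≢ 0ℚ) (sym (ℕ.m∸n+n≡m r≤t)) x≢0)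

    spread : ℕ → ℚ
    spread j = toℚ ((D ℕ.^ r ∸ 1) ℕ.^ j) * ρ ^ (j ℕ.* r)

    spread-< : ∀ {ε} j → toℚ ((D ℕ.^ r ∸ 1) ℕ.^ j) < ε * toℚ (suc (D ℕ.^ r ∸ 1) ℕ.^ j) → spread j < ε
    spread-< {ε} j small = begin-strict
      toℚ (p ℕ.^ j) * ρ ^ b               <⟨ *-monoˡ-<-pos (ρ ^ b) {{ρ^-positive b}} small ⟩
      ε * toℚ (suc p ℕ.^ j) * ρ ^ b       ≡⟨ *-assoc ε (toℚ (suc p ℕ.^ j)) (ρ ^ b) ⟩
      ε * (toℚ (suc p ℕ.^ j) * ρ ^ b)     ≡⟨ cong (λ v → ε * (toℚ (v ℕ.^ j) * ρ ^ b)) 1+p≡D^r ⟩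
      ε * (toℚ ((D ℕ.^ r) ℕ.^ j) * ρ ^ b) ≡⟨ cong (λ v → ε * (toℚ v * ρ ^ b)) D^r^j≡D^b ⟩
      ε * (toℚ (D ℕ.^ b) * ρ ^ b)         ≡⟨ cong (ε *_) (D^c*ρ^c≡1 b) ⟩
      ε * 1ℚ                              ≡⟨ *-identityʳ ε ⟩
      ε                                   ∎
      where
      open ≤-Reasoning
      p = D ℕ.^ r ∸ 1
      b = j ℕ.* r
      1+p≡D^r : suc p ≡ D ℕ.^ r
      1+p≡D^r = ℕ.m+[n∸m]≡n (ℕ.m^n>0 D {{D-nonZero}} r)
      D^r^j≡D^b : (D ℕ.^ r) ℕ.^ j ≡ D ℕ.^ b
      D^r^j≡D^b = trans (ℕ.^-*-assoc D r j) (cong (D ℕ.^_) (ℕ.*-comm r j))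

    spread-small : ∀ {ε} → 0ℚ < ε → Σ[ j ∈ ℕ ] spread j < ε
    spread-small 0<ε = let j , small = eventually-small (D ℕ.^ r ∸ 1) 0<ε in j , spread-< j small

    window-start : ℕ → ℚ
    window-start j = toℚ (proj₁ (bounded-after j)) * ρ ^ (j ℕ.* r)

    x-in-window : ∀ j m → suc (j ℕ.* r) ℕ.≤ m → xᴱ m ≢ 0ℚ →
                  window-start j ≤ xᴱ m × xᴱ m ≤ window-start j + spread j
    x-in-window j (suc t) (s≤s b≤t) x≢0 =
      subst (λ m → window-start j ≤ xᴱ (suc m) × xᴱ (suc m) ≤ window-start j + spread j)
            (ℕ.m∸n+n≡m b≤t) (x-window adm-a (proj₂ (bounded-after j)))
      where
      a = t ∸ j ℕ.* r
      adm-a : AdmissibleTime a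
      adm-a = x≢0⇒admissibleTime a (j ℕ.* K)
        (subst (λ m → xᴱ (suc m) ≢ 0ℚ) (trans (sym (ℕ.m∸n+n≡m b≤t)) (cong (a ℕ.+_) (sym (ℕ.*-assoc j K 2)))) x≢0)

    x-cauchy : ∀ {ε} → 0ℚ < ε →
               Σ[ N ∈ ℕ ] (∀ m m′ → N ℕ.≤ m → N ℕ.≤ m′ → xᴱ m ≢ 0ℚ → xᴱ m′ ≢ 0ℚ → ∣ xᴱ m - xᴱ m′ ∣ < ε)
    x-cauchy 0<ε = let j , spread<ε = spread-small 0<ε in suc (j ℕ.* r) , λ m m′ N≤m N≤m′ x≢0 x′≢0 →
      let lo≤x , x≤hi = x-in-window j m N≤m x≢0
          lo≤x′ , x′≤hi = x-in-window j m′ N≤m′ x′≢0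
      in ≤-<-trans (∣-∣≤-window lo≤x x≤hi lo≤x′ x′≤hi) spread<ε

open import Defs
open import Data.Nat as ℕ using (ℕ; _≤_; _<_)
open import Data.Nat.Divisibility using (_∣_)
open import Data.Fin using (Fin)
open import Data.Rational as ℚ using (ℚ; 0ℚ; ∣_∣; _-_)
open import Data.Product using (Σ; _×_; _,_)
open import Relation.Binary.PropositionalEquality using (_≢_)
open import Relation.Nullary using (¬_)
open Convergence using (module Limit)
open Mixing using (module Minorisation)
open RationalFacts using (_^_)
open import Data.Rational.Properties using (positive⁻¹)

proposition2 : (n : ℕ) (0<n : 0 < n) (_*_ : Fin n → Fin n → Fin n) → IsQuasigroup _*_ →
    (k : ℕ) → 1 ≤ k →
    -- (1)
    (((m : ℕ) → 1 ≤ m → 2 ∣ m → 0ℚ ℚ.< x _*_ k (E k 0<n) m) ×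
     ((m′ : ℕ) → 1 ≤ m′ → ¬ (2 ∣ m′) → 0ℚ ℚ.< x _*_ k (E k 0<n) m′ →
        (m : ℕ) → m′ ≤ m → 0ℚ ℚ.< x _*_ k (E k 0<n) m)) ×
    -- (2): along the m ≥ 1 with x_E(m) ≠ 0, x_E(m) converges to a limit c > 0,
    -- expressed as: eventually bounded below by a positive rational, and Cauchy
    ((Σ ℚ λ δ → 0ℚ ℚ.< δ × Σ ℕ λ M → (m : ℕ) → M ≤ m → 1 ≤ m →
        x _*_ k (E k 0<n) m ≢ 0ℚ → δ ℚ.≤ x _*_ k (E k 0<n) m) ×
     ((ε : ℚ) → 0ℚ ℚ.< ε → Σ ℕ λ N → (m m′ : ℕ) → N ≤ m → N ≤ m′ → 1 ≤ m → 1 ≤ m′ →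
        x _*_ k (E k 0<n) m ≢ 0ℚ → x _*_ k (E k 0<n) m′ ≢ 0ℚ →
        ∣ x _*_ k (E k 0<n) m - x _*_ k (E k 0<n) m′ ∣ ℚ.< ε))
-- The argument does not use 1 ≤ k: for k = 0 the only state is the empty vector.
proposition2 n 0<n _*_ Qg k _ =
  (x-positive-at-even , λ m′ _ → x-positive-after-odd m′) ,
  (ρ ^ r , positive⁻¹ (ρ ^ r) {{ρ^-positive r}} , ℕ.suc r , λ m r<m _ → x-bounded-below m r<m) ,
  (λ ε 0<ε → let N , cauchy = x-cauchy 0<ε in N , λ m m′ N≤m N≤m′ _ _ → cauchy m m′ N≤m N≤m′)
  where
  open Limit _*_ Qg k 0<n
  open Minorisation _*_ Qg k 0<n using (r)
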